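{- For every $n\geqslant 1$, $$\sum_{\pi\in\mathfrak{S}_n^B}x^{\operatorname{des}_A(\pi)+1}y^{\operatorname{des}_B(\pi)}q^{\mathrm{neg}(\pi)}=\sum_{\sigma\in\mathcal{Q}_{n+1}^{(0)}}x^{\mathrm{lap}(\sigma)}y^{\mathrm{ap}(\sigma)}q^{\mathrm{even}(\sigma)}.$$
   Context: $\mathfrak{S}_n^B$ is the group of signed permutations $\pi=\pi(1)\cdots\pi(n)$ of $\pm[n]$; $\mathrm{neg}(\pi)$ is the number of negative entries; $\operatorname{des}_A(\pi)=\#\{i\in\{1,\ldots,n-1\}:\pi(i)>\pi(i+1)\}$; $\operatorname{des}_B(\pi)=\#\{i\in\{0,\ldots,n-1\}:\pi(i)>\pi(i+1)\}$ with $\pi(0)=0$. A Stirling permutation of a multiset is a word $\sigma$ using each element of the multiset with its multiplicity such that whenever $\sigma_i=\sigma_j$ with $i<j$, we have $\sigma_s>\sigma_i$ for all $i<s<j$. $\mathcal{Q}_{n+1}^{(0)}$ is the set of Stirling permutations $\sigma=\sigma_1\cdots\sigma_{2n+1}$ of the multiset $\{1,2,2,3,3,\ldots,n+1,n+1\}$ (the element $1$ appears once, every other element twice). Set $\sigma_0=0$. $\mathrm{lap}(\sigma)=\#\{i\in\{1,\ldots,2n\}:\sigma_{i-1}<\sigma_i=\sigma_{i+1}\}$; $\mathrm{ap}(\sigma)=\#\{i\in\{2,\ldots,2n\}:\sigma_{i-1}<\sigma_i=\sigma_{i+1}\}$; $\mathrm{even}(\sigma)$ is the number of values $v\in\{2,\ldots,n+1\}$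 whose first occurrence in $\sigma$ is at an even position. -}

module Defs where

open import Data.Bool using (Bool; true; false; _∧_; if_then_else_)
open import Data.Nat using (ℕ; zero; suc; _+_; _*_; _∸_)
import Data.Nat as ℕ
open import Data.Integer using (ℤ; +_; -_; ∣_∣)
import Data.Integer as ℤ
open import Data.List using (List; []; _∷_; _++_; map; length; concatMap; filterᵇ; upTo)
open import Relation.Nullary.Decidable using (⌊_⌋)

allᵇ : {A : Set} → (A → Bool) → List A → Bool
allᵇ p []       = true
allᵇ p (x ∷ xs) = p x ∧ allᵇ p xs

-- [a..b] = a , a+1 , ... , b  (empty if b < a)
range : ℕ → ℕ → List ℕ
range a b = map (λ k → a + k) (upTo (suc b ∸ a))

countᵇ : {A : Set} → (A → Bool) → List A → ℕ
countᵇ p xs = length (filterᵇ p xs)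

words : {A : Set} → ℕ → List A → List (List A)
words zero    al = [] ∷ []
words (suc k) al = concatMap (λ a → map (a ∷_) (words k al)) al

-- 1-indexed access with default 0 (so position 0 gives the convention σ₀ = 0 / π(0) = 0)
nth : {A : Set} → A → List A → ℕ → A
nth d []       _       = d
nth d (x ∷ xs) zero    = x
nth d (x ∷ xs) (suc i) = nth d xs i

at : {A : Set} → A → List A → ℕ → A
at d w zero    = d
at d w (suc i) = nth d w i

signedAlphabet : ℕ → List ℤ
signedAlphabet n = map +_ (range 1 n) ++ map (λ k → - (+ k)) (range 1 n)

isSignedPerm : ℕ → List ℤ → Bool
isSignedPerm n w = allᵇ (λ k → ⌊ countᵇ (λ e → ⌊ ∣ e ∣ ℕ.≟ k ⌋) w ℕ.≟ 1 ⌋) (range 1 n)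

-- 𝔖ₙᴮ (each element listed exactly once)
SB : ℕ → List (List ℤ)
SB n = filterᵇ (isSignedPerm n) (words n (signedAlphabet n))

neg : List ℤ → ℕ
neg π = countᵇ (λ e → ⌊ e ℤ.<? + 0 ⌋) π

desA : ℕ → List ℤ → ℕ
desA n π = countᵇ (λ i → ⌊ at (+ 0) π (suc i) ℤ.<? at (+ 0) π i ⌋) (range 1 (n ∸ 1))

desB : ℕ → List ℤ → ℕ
desB n π = countᵇ (λ i → ⌊ at (+ 0) π (suc i) ℤ.<? at (+ 0) π i ⌋) (range 0 (n ∸ 1))

isStirling : List ℕ → Bool
isStirling σ =
  allᵇ (λ i → allᵇ (λ j →
        if ⌊ i ℕ.<? j ⌋ ∧ ⌊ at 0 σ i ℕ.≟ at 0 σ j ⌋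
        then allᵇ (λ s → ⌊ at 0 σ i ℕ.<? at 0 σ s ⌋) (range (suc i) (j ∸ 1))
        else true)
      (range 1 (length σ)))
    (range 1 (length σ))

hasMultiset : ℕ → List ℕ → Bool
hasMultiset n σ =
  ⌊ countᵇ (λ e → ⌊ e ℕ.≟ 1 ⌋) σ ℕ.≟ 1 ⌋ ∧
  allᵇ (λ v → ⌊ countᵇ (λ e → ⌊ e ℕ.≟ v ⌋) σ ℕ.≟ 2 ⌋) (range 2 (suc n))

-- 𝒬ₙ₊₁⁽⁰⁾ (each element listed exactly once)
Q0 : ℕ → List (List ℕ)
Q0 n = filterᵇ (λ σ → hasMultiset n σ ∧ isStirling σ)
               (words (suc (2 * n)) (range 1 (suc n)))

plateauAt : List ℕ → ℕ → Bool
plateauAt σ i = ⌊ at 0 σ (i ∸ 1) ℕ.<? at 0 σ i ⌋ ∧ ⌊ at 0 σ i ℕ.≟ at 0 σ (suc i) ⌋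

lap : ℕ → List ℕ → ℕ
lap n σ = countᵇ (plateauAt σ) (range 1 (2 * n))

ap : ℕ → List ℕ → ℕ
ap n σ = countᵇ (plateauAt σ) (range 2 (2 * n))

-- position (1-indexed) of the first occurrence of v in σ (0 if absent)
firstPos : ℕ → List ℕ → ℕ
firstPos v []       = 0
firstPos v (x ∷ xs) = if ⌊ x ℕ.≟ v ⌋ then 1 else suc (firstPos v xs)

isEven : ℕ → Bool
isEven zero          = true
isEven (suc zero)    = false
isEven (suc (suc k)) = isEven k

even : ℕ → List ℕ → ℕ
even n σ = countᵇ (λ v → isEven (firstPos v σ)) (range 2 (suc n))

coeffB : ℕ → ℕ → ℕ → ℕ → ℕ
coeffB n a b c = countᵇ (λ π → ⌊ suc (desA n π) ℕ.≟ a ⌋ ∧ ⌊ desB n π ℕ.≟ b ⌋ ∧ ⌊ neg π ℕ.≟ c ⌋) (SB n)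

coeffQ : ℕ → ℕ → ℕ → ℕ → ℕ
coeffQ n a b c = countᵇ (λ σ → ⌊ lap n σ ℕ.≟ a ⌋ ∧ ⌊ ap n σ ℕ.≟ b ⌋ ∧ ⌊ even n σ ℕ.≟ c ⌋) (Q0 n)

{-# OPTIONS --safe #-}
-- Both families are generated by the same insertion process.  A signed permutation of [n+1] arises
-- uniquely from one of [n] by inserting n+1 or −(n+1) into one of its n+1 gaps; a Stirling permutation
-- in Q⁽⁰⁾ₙ₊₂ arises uniquely from one in Q⁽⁰⁾ₙ₊₁ by inserting the adjacent pair (n+2)(n+2) into one of
-- its 2n+2 gaps.  In both cases the statistics of the 2n+2 children are determined by those of the
-- parent, in the same way: summing any test function F of the statistics over the children gives
-- H n F of the parent's statistics.  So the sums of F over both families agree for every F, by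
-- induction from n = 1, and for F the indicator of (a, b, c) these sums are the coefficients.
module Submission where

open import Algebra.Bundles using (CommutativeMonoid)
open import Data.Bool using (Bool; true; false; not; T; T?; _∧_; _∨_; if_then_else_)
open import Data.Bool.Properties using (T-∧; ∧-assoc; ∧-zeroʳ; if-eta; ∧-commutativeMonoid)
open import Data.Integer as ℤ using (ℤ; -[1+_]; ∣_∣; +<+; -<+; -<-)
import Data.Integer.Properties as ℤ
open import Data.List using (List; []; _∷_; _++_; [_]; map; length; concatMap; filterᵇ; upTo)
open import Data.List.Properties using (map-++; map-∘; map-cong-local; map-applyUpTo; upTo-∷ʳ; length-++; ∷-injectiveˡ; ∷-injectiveʳ; filter-++; filter-all; filter-none)
open import Data.List.Membership.Propositional using (_∈_; find; lose)
open import Data.List.Membership.Propositional.Properties using (∈-map⁺; ∈-map⁻; ∈-++⁺ˡ; ∈-++⁺ʳ; ∈-++⁻; ∈-concatMap⁺; ∈-concatMap⁻; ∈-filter⁺; ∈-filter⁻; ∈-upTo⁺; ∈-upTo⁻)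
open import Data.List.Membership.Propositional.Properties.WithK using (unique∧set⇒bag)
open import Data.List.Relation.Binary.BagAndSetEquality using (∼bag⇒↭)
open import Data.List.Relation.Binary.Permutation.Propositional using (_↭_)
import Data.List.Relation.Binary.Permutation.Propositional.Properties as ↭
open import Data.List.Relation.Unary.All as All using (All; []; _∷_)
import Data.List.Relation.Unary.All.Properties as All
open import Data.List.Relation.Unary.AllPairs using ([]; _∷_)
open import Data.List.Relation.Unary.Any using (here; there)
open import Data.List.Relation.Unary.Unique.Propositional using (Unique)
import Data.List.Relation.Unary.Unique.Propositional.Properties as Unique
open import Data.Nat using (ℕ; zero; suc; _+_; _*_; _∸_; _<_; _≤_; s≤s; z≤n; s≤s⁻¹)
import Data.Nat as ℕ
open import Data.Nat.ListAction using (sum)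
open import Data.Nat.ListAction.Properties using (sum-++; sum-↭)
open import Data.Nat.Properties using (suc-injective; <-irrefl; <⇒≢; <⇒≱; <⇒≤; n<1+n; m≤n⇒m≤1+n; m<1+n⇒m<n∨m≡n; +-comm; +-assoc; +-suc; +-identityʳ; +-∸-assoc; m+n∸n≡m; m∸n+n≡m; +-cancelʳ-≡; +-commutativeSemigroup)
open import Data.Nat.Tactic.RingSolver using (solve-∀)
open import Data.Product using (∃-syntax; _×_; _,_; proj₁; proj₂)
open import Data.Sum using (_⊎_; inj₁; inj₂)
open import Function using (_∘_; id)
open import Function.Bundles using (mk⇔; Equivalence)
open import Relation.Binary.PropositionalEquality hiding ([_])
open import Relation.Nullary using (¬_; Dec; yes; no; contradiction)
open import Relation.Nullary.Decidable using (⌊_⌋; toWitness; fromWitness)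
open import Algebra.Properties.CommutativeSemigroup +-commutativeSemigroup using () renaming (x∙yz≈y∙xz to +-exchange)
open import Algebra.Properties.CommutativeSemigroup (CommutativeMonoid.commutativeSemigroup ∧-commutativeMonoid) using () renaming (interchange to ∧-interchange)
open import Defs

𝟙 : Bool → ℕ
𝟙 true  = 1
𝟙 false = 0

⌊⌋-true : {P : Set} (d : Dec P) → P → ⌊ d ⌋ ≡ true
⌊⌋-true (yes _) _ = refl
⌊⌋-true (no ¬p) p = contradiction p ¬p

⌊⌋-false : {P : Set} (d : Dec P) → ¬ P → ⌊ d ⌋ ≡ false
⌊⌋-false (yes p) ¬p = contradiction p ¬p
⌊⌋-false (no _)  _  = refl

⌊⌋-true⁻ : {P : Set} (d : Dec P) → ⌊ d ⌋ ≡ true → P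
⌊⌋-true⁻ (yes p) _ = p

⌊⌋-cong : {P Q : Set} (p? : Dec P) (q? : Dec Q) → (P → Q) → (Q → P) → ⌊ p? ⌋ ≡ ⌊ q? ⌋
⌊⌋-cong (yes _) (yes _) _   _   = refl
⌊⌋-cong (yes p) (no ¬q) p→q _   = contradiction (p→q p) ¬q
⌊⌋-cong (no ¬p) (yes q) _   q→p = contradiction (q→p q) ¬p
⌊⌋-cong (no _)  (no _)  _   _   = refl

<?-suc : (a b : ℕ) → ⌊ suc a ℕ.<? suc b ⌋ ≡ ⌊ a ℕ.<? b ⌋
<?-suc a b = ⌊⌋-cong (suc a ℕ.<? suc b) (a ℕ.<? b) ℕ.s≤s⁻¹ s≤s

if-∧-distrib : (c a b : Bool) → (if c then a ∧ b else true) ≡ (if c then a else true) ∧ (if c then b else true)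
if-∧-distrib true  a b = refl
if-∧-distrib false a b = refl

allᵇ⁻ : {A : Set} (p : A → Bool) {xs : List A} → T (allᵇ p xs) → ∀ {x} → x ∈ xs → T (p x)
allᵇ⁻ p {y ∷ xs} t (here refl) = proj₁ (Equivalence.to T-∧ t)
allᵇ⁻ p {y ∷ xs} t (there x∈)  = allᵇ⁻ p (proj₂ (Equivalence.to T-∧ t)) x∈

allᵇ⁺ : {A : Set} (p : A → Bool) {xs : List A} → (∀ {x} → x ∈ xs → T (p x)) → T (allᵇ p xs)
allᵇ⁺ p {[]}     _   = _
allᵇ⁺ p {y ∷ xs} all = Equivalence.from T-∧ (all (here refl) , allᵇ⁺ p (all ∘ there))

allᵇ-true : {A : Set} {f : A → Bool} (xs : List A) → (∀ {x} → x ∈ xs → f x ≡ true) → allᵇ f xs ≡ true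
allᵇ-true []       _   = refl
allᵇ-true (x ∷ xs) all = cong₂ _∧_ (all (here refl)) (allᵇ-true xs (all ∘ there))

allᵇ-map : {A B : Set} (f : B → Bool) (g : A → B) (xs : List A) → allᵇ f (map g xs) ≡ allᵇ (f ∘ g) xs
allᵇ-map f g []       = refl
allᵇ-map f g (x ∷ xs) = cong (f (g x) ∧_) (allᵇ-map f g xs)

allᵇ-cong : {A : Set} {f g : A → Bool} (xs : List A) → (∀ {x} → x ∈ xs → f x ≡ g x) → allᵇ f xs ≡ allᵇ g xs
allᵇ-cong []       f≗g = refl
allᵇ-cong (x ∷ xs) f≗g = cong₂ _∧_ (f≗g (here refl)) (allᵇ-cong xs (f≗g ∘ there))

allᵇ-++ : {A : Set} (f : A → Bool) (xs ys : List A) → allᵇ f (xs ++ ys) ≡ allᵇ f xs ∧ allᵇ f ys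
allᵇ-++ f []       ys = refl
allᵇ-++ f (x ∷ xs) ys = trans (cong (f x ∧_) (allᵇ-++ f xs ys)) (sym (∧-assoc (f x) _ _))

allᵇ-∧ : {A : Set} (f g : A → Bool) (xs : List A) → allᵇ (λ x → f x ∧ g x) xs ≡ allᵇ f xs ∧ allᵇ g xs
allᵇ-∧ f g []       = refl
allᵇ-∧ f g (x ∷ xs) = trans (cong ((f x ∧ g x) ∧_) (allᵇ-∧ f g xs)) (∧-interchange (f x) (g x) _ _)

upTo-suc : (L : ℕ) → upTo (suc L) ≡ 0 ∷ map suc (upTo L)
upTo-suc L = cong (0 ∷_) (sym (map-applyUpTo id suc L))

at≡nth : {A : Set} (d : A) (w : List A) (i : ℕ) → at d w i ≡ nth d (d ∷ w) i
at≡nth d w zero    = refl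
at≡nth d w (suc i) = refl

allᵇ-nth : {A : Set} (d : A) (f : A → Bool) (w : List A) → allᵇ (f ∘ nth d w) (upTo (length w)) ≡ allᵇ f w
allᵇ-nth d f []      = refl
allᵇ-nth d f (x ∷ w) = begin
  allᵇ (f ∘ nth d (x ∷ w)) (upTo (suc (length w)))             ≡⟨ cong (allᵇ (f ∘ nth d (x ∷ w))) (upTo-suc (length w)) ⟩
  f x ∧ allᵇ (f ∘ nth d (x ∷ w)) (map suc (upTo (length w)))   ≡⟨ cong (f x ∧_) (allᵇ-map (f ∘ nth d (x ∷ w)) suc (upTo (length w))) ⟩
  f x ∧ allᵇ (f ∘ nth d w) (upTo (length w))                   ≡⟨ cong (f x ∧_) (allᵇ-nth d f w) ⟩
  f x ∧ allᵇ f w                                               ∎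
  where open ≡-Reasoning

2*suc : (n : ℕ) → 2 * suc n ≡ suc (suc (2 * n))
2*suc = solve-∀

1+m+n∸n≡1+m : (m n : ℕ) → suc (m + n) ∸ n ≡ suc m
1+m+n∸n≡1+m m n = m+n∸n≡m (suc m) n

∑ : {A : Set} → List A → (A → ℕ) → ℕ
∑ xs F = sum (map F xs)

∑-++ : {A : Set} (xs ys : List A) (F : A → ℕ) → ∑ (xs ++ ys) F ≡ ∑ xs F + ∑ ys F
∑-++ xs ys F = trans (cong sum (map-++ F xs ys)) (sum-++ (map F xs) (map F ys))

∑-map : {A B : Set} (g : A → B) (xs : List A) (F : B → ℕ) → ∑ (map g xs) F ≡ ∑ xs (F ∘ g)
∑-map g xs F = cong sum (sym (map-∘ xs))

∑-concatMap : {A B : Set} (f : A → List B) (xs : List A) (F : B → ℕ) →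
              ∑ (concatMap f xs) F ≡ ∑ xs (λ x → ∑ (f x) F)
∑-concatMap f []       F = refl
∑-concatMap f (x ∷ xs) F =
  trans (∑-++ (f x) (concatMap f xs) F) (cong (∑ (f x) F +_) (∑-concatMap f xs F))

∑-cong : {A : Set} {F G : A → ℕ} (xs : List A) → (∀ {x} → x ∈ xs → F x ≡ G x) → ∑ xs F ≡ ∑ xs G
∑-cong xs F≗G = cong sum (map-cong-local (All.tabulate F≗G))

∑-↭ : {A : Set} {xs ys : List A} (F : A → ℕ) → xs ↭ ys → ∑ xs F ≡ ∑ ys F
∑-↭ F p = sum-↭ (↭.map⁺ F p)

∑-upTo-suc : (L : ℕ) (F : ℕ → ℕ) → ∑ (upTo (suc L)) F ≡ F 0 + ∑ (upTo L) (F ∘ suc)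
∑-upTo-suc L F = trans (cong (λ l → ∑ l F) (upTo-suc L)) (cong (F 0 +_) (∑-map suc (upTo L) F))

∑-upTo-∷ʳ : (n : ℕ) (F : ℕ → ℕ) → ∑ (upTo (suc n)) F ≡ F n + ∑ (upTo n) F
∑-upTo-∷ʳ n F = begin
  ∑ (upTo (suc n)) F          ≡⟨ cong (λ l → ∑ l F) (upTo-∷ʳ n) ⟨
  ∑ (upTo n ++ [ n ]) F       ≡⟨ ∑-++ (upTo n) [ n ] F ⟩
  ∑ (upTo n) F + (F n + 0)    ≡⟨ +-comm (∑ (upTo n) F) (F n + 0) ⟩
  F n + 0 + ∑ (upTo n) F      ≡⟨ cong (_+ ∑ (upTo n) F) (+-identityʳ (F n)) ⟩
  F n + ∑ (upTo n) F          ∎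
  where open ≡-Reasoning

countᵇ≡∑ : {A : Set} (p : A → Bool) (xs : List A) → countᵇ p xs ≡ ∑ xs (𝟙 ∘ p)
countᵇ≡∑ p []       = refl
countᵇ≡∑ p (x ∷ xs) with p x
... | true  = cong suc (countᵇ≡∑ p xs)
... | false = countᵇ≡∑ p xs

∑𝟙≡0⇒All : {A : Set} (p : A → Bool) (xs : List A) → ∑ xs (𝟙 ∘ p) ≡ 0 → All (λ x → p x ≡ false) xs
∑𝟙≡0⇒All p []       _ = []
∑𝟙≡0⇒All p (x ∷ xs) e with p x in px
... | false = px ∷ ∑𝟙≡0⇒All p xs e

All⇒∑𝟙≡0 : {A : Set} (p : A → Bool) {xs : List A} → All (λ x → p x ≡ false) xs → ∑ xs (𝟙 ∘ p) ≡ 0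
All⇒∑𝟙≡0 p []                  = refl
All⇒∑𝟙≡0 p (px≡false ∷ ps) rewrite px≡false = All⇒∑𝟙≡0 p ps

split-at-first : {A : Set} (p : A → Bool) (xs : List A) {k : ℕ} → ∑ xs (𝟙 ∘ p) ≡ suc k →
                 ∃[ ys ] ∃[ v ] ∃[ zs ] xs ≡ ys ++ v ∷ zs × p v ≡ true
                   × ∑ ys (𝟙 ∘ p) ≡ 0 × ∑ zs (𝟙 ∘ p) ≡ k
split-at-first p (x ∷ xs) e with p x in px
... | true  = [] , x , xs , refl , px , refl , suc-injective e
... | false with split-at-first p xs e
...   | ys , v , zs , refl , pv , ys₀ , zsₖ =
  x ∷ ys , v , zs , refl , pv , trans (cong (λ b → 𝟙 b + ∑ ys (𝟙 ∘ p)) px) ys₀ , zsₖ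

unique∧sameMembers⇒↭ : {A : Set} {xs ys : List A} → Unique xs → Unique ys →
                       (∀ {x} → x ∈ xs → x ∈ ys) → (∀ {x} → x ∈ ys → x ∈ xs) → xs ↭ ys
unique∧sameMembers⇒↭ uxs uys to from = ∼bag⇒↭ (unique∧set⇒bag uxs uys (mk⇔ to from))

concatMap-unique : {A B : Set} (f : A → List B) {xs : List A} → Unique xs →
                   (∀ {x} → x ∈ xs → Unique (f x)) →
                   (∀ {x y w} → x ∈ xs → y ∈ xs → w ∈ f x → w ∈ f y → x ≡ y) →
                   Unique (concatMap f xs)
concatMap-unique f {[]}     _            _     _        = []
concatMap-unique f {x ∷ xs} (x∉xs ∷ uxs) ufx disjoint =
  Unique.++⁺ (ufx (here refl))
             (concatMap-unique f uxs (ufx ∘ there) (λ x∈ y∈ → disjoint (there x∈) (there y∈)))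
             separated
  where
  separated : ∀ {w} → ¬ (w ∈ f x × w ∈ concatMap f xs)
  separated (w∈fx , w∈rest) with y , y∈xs , w∈fy ← find (∈-concatMap⁻ f {xs = xs} w∈rest) =
    All.lookup x∉xs y∈xs (disjoint (here refl) (there y∈xs) w∈fx w∈fy)

-- Reading the parent back from a child makes the children of distinct parents disjoint.
↭-concatMap-children : {A B : Set} (children : A → List B) (parent : B → A) {xs : List A} {ys : List B} →
  Unique xs → Unique ys → (∀ {x} → x ∈ xs → Unique (children x)) →
  (∀ {x w} → x ∈ xs → w ∈ children x → parent w ≡ x) →
  (∀ {x w} → x ∈ xs → w ∈ children x → w ∈ ys) →
  (∀ {w} → w ∈ ys → ∃[ x ] x ∈ xs × w ∈ children x) →
  ys ↭ concatMap children xs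
↭-concatMap-children children parent uxs uys uch retract child∈ parent∈ =
  unique∧sameMembers⇒↭ uys
    (concatMap-unique children uxs uch (λ x∈ y∈ p q → trans (sym (retract x∈ p)) (retract y∈ q)))
    (λ w∈ → let x , x∈ , w∈ch = parent∈ w∈ in ∈-concatMap⁺ children (lose x∈ w∈ch))
    (λ w∈ → let x , x∈ , w∈ch = find (∈-concatMap⁻ children w∈) in child∈ x∈ w∈ch)

∈-words⁻ : {A : Set} (k : ℕ) (al : List A) {w : List A} → w ∈ words k al → length w ≡ k × All (_∈ al) w
∈-words⁻ zero    al (here refl) = refl , []
∈-words⁻ (suc k) al w∈
  with a , a∈ , w∈a∷ ← find (∈-concatMap⁻ (λ a → map (a ∷_) (words k al)) {xs = al} w∈)
  with w , w∈k , refl ← ∈-map⁻ (a ∷_) w∈a∷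
  with len , all ← ∈-words⁻ k al w∈k = cong suc len , a∈ ∷ all

∈-words⁺ : {A : Set} (k : ℕ) (al : List A) {w : List A} → length w ≡ k → All (_∈ al) w → w ∈ words k al
∈-words⁺ zero    al {[]}    refl []          = here refl
∈-words⁺ (suc k) al {a ∷ w} len  (a∈ ∷ all) =
  ∈-concatMap⁺ (λ a → map (a ∷_) (words k al)) (lose a∈ (∈-map⁺ (a ∷_) (∈-words⁺ k al (suc-injective len) all)))

words-unique : {A : Set} (k : ℕ) {al : List A} → Unique al → Unique (words k al)
words-unique zero    u = [] ∷ []
words-unique (suc k) u =
  concatMap-unique _ u (λ _ → Unique.map⁺ ∷-injectiveʳ (words-unique k u)) same-head
  where
  same-head : ∀ {a b w} → _ → _ → w ∈ map (a ∷_) (words k _) → w ∈ map (b ∷_) (words k _) → a ≡ b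
  same-head _ _ p q with _ , _ , refl ← ∈-map⁻ _ p | _ , _ , refl ← ∈-map⁻ _ q = refl

∈-filterᵇ⁻ : {A : Set} (p : A → Bool) {xs : List A} {x : A} → x ∈ filterᵇ p xs → x ∈ xs × T (p x)
∈-filterᵇ⁻ p = ∈-filter⁻ (T? ∘ p)

∈-filterᵇ⁺ : {A : Set} (p : A → Bool) {xs : List A} {x : A} → x ∈ xs → T (p x) → x ∈ filterᵇ p xs
∈-filterᵇ⁺ p = ∈-filter⁺ (T? ∘ p)

insertions : {A : Set} → List A → List A → List (List A)
insertions b []       = (b ++ []) ∷ []
insertions b (x ∷ xs) = (b ++ x ∷ xs) ∷ map (x ∷_) (insertions b xs)

∈-insertions⁺ : {A : Set} (b xs ys : List A) → xs ++ b ++ ys ∈ insertions b (xs ++ ys)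
∈-insertions⁺ b []       []       = here refl
∈-insertions⁺ b []       (y ∷ ys) = here refl
∈-insertions⁺ b (x ∷ xs) ys       = there (∈-map⁺ (x ∷_) (∈-insertions⁺ b xs ys))

∈-insertions⁻ : {A : Set} (b zs : List A) {w : List A} → w ∈ insertions b zs →
                ∃[ xs ] ∃[ ys ] zs ≡ xs ++ ys × w ≡ xs ++ b ++ ys
∈-insertions⁻ b []       (here refl) = [] , [] , refl , refl
∈-insertions⁻ b (z ∷ zs) (here refl) = [] , z ∷ zs , refl , refl
∈-insertions⁻ b (z ∷ zs) (there w∈)
  with w , w∈zs , refl ← ∈-map⁻ (z ∷_) w∈
  with xs , ys , refl , refl ← ∈-insertions⁻ b zs w∈zs = z ∷ xs , ys , refl , refl

insertions-unique : {A : Set} (v : A) (b : List A) {zs : List A} → All (v ≢_) zs →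
                    Unique (insertions (v ∷ b) zs)
insertions-unique v b {[]}     []          = [] ∷ []
insertions-unique v b {z ∷ zs} (v≢z ∷ v∉) =
  All.tabulate front-differs ∷ Unique.map⁺ ∷-injectiveʳ (insertions-unique v b v∉)
  where
  front-differs : ∀ {w} → w ∈ map (z ∷_) (insertions (v ∷ b) zs) → v ∷ b ++ z ∷ zs ≢ w
  front-differs w∈ eq with _ , _ , refl ← ∈-map⁻ (z ∷_) w∈ = v≢z (∷-injectiveˡ eq)

module _ {A : Set} (b zs : List A) {w : List A} (w∈ : w ∈ insertions b zs) where

  ∑-insertions : (F : A → ℕ) → ∑ w F ≡ ∑ b F + ∑ zs F
  ∑-insertions F with xs , ys , refl , refl ← ∈-insertions⁻ b zs w∈ = begin
    ∑ (xs ++ b ++ ys) F        ≡⟨ ∑-++ xs (b ++ ys) F ⟩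
    ∑ xs F + ∑ (b ++ ys) F     ≡⟨ cong (∑ xs F +_) (∑-++ b ys F) ⟩
    ∑ xs F + (∑ b F + ∑ ys F)  ≡⟨ +-exchange (∑ xs F) (∑ b F) (∑ ys F) ⟩
    ∑ b F + (∑ xs F + ∑ ys F)  ≡⟨ cong (∑ b F +_) (∑-++ xs ys F) ⟨
    ∑ b F + ∑ (xs ++ ys) F     ∎
    where open ≡-Reasoning

  length-insertions : length w ≡ length b + length zs
  length-insertions with xs , ys , refl , refl ← ∈-insertions⁻ b zs w∈ = begin
    length (xs ++ b ++ ys)               ≡⟨ length-++ xs ⟩
    length xs + length (b ++ ys)         ≡⟨ cong (length xs +_) (length-++ b) ⟩
    length xs + (length b + length ys)   ≡⟨ +-exchange (length xs) (length b) (length ys) ⟩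
    length b + (length xs + length ys)   ≡⟨ cong (length b +_) (length-++ xs) ⟨
    length b + length (xs ++ ys)         ∎
    where open ≡-Reasoning

  All-insertions : {P : A → Set} → All P b → All P zs → All P w
  All-insertions Pb Pzs with xs , ys , refl , refl ← ∈-insertions⁻ b zs w∈ =
    All.++⁺ (All.++⁻ˡ xs Pzs) (All.++⁺ Pb (All.++⁻ʳ xs Pzs))

  All-insertions⁻ : {P : A → Set} → All P w → All P zs
  All-insertions⁻ Pw with xs , ys , refl , refl ← ∈-insertions⁻ b zs w∈ =
    All.++⁺ (All.++⁻ˡ xs Pw) (All.++⁻ʳ b (All.++⁻ʳ xs Pw))

  filterᵇ-insertions : (p : A → Bool) → All (λ x → p x ≡ false) b → All (λ x → p x ≡ true) zs →
                       filterᵇ p w ≡ zs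
  filterᵇ-insertions p ¬pb pzs with xs , ys , refl , refl ← ∈-insertions⁻ b zs w∈ = begin
    filterᵇ p (xs ++ b ++ ys)                         ≡⟨ filter-++ P? xs (b ++ ys) ⟩
    filterᵇ p xs ++ filterᵇ p (b ++ ys)               ≡⟨ cong (filterᵇ p xs ++_) (filter-++ P? b ys) ⟩
    filterᵇ p xs ++ filterᵇ p b ++ filterᵇ p ys       ≡⟨ cong₂ (λ l m → l ++ m ++ filterᵇ p ys) kept dropped ⟩
    xs ++ [] ++ filterᵇ p ys                          ≡⟨ cong (xs ++_) (filter-all P? (All.++⁻ʳ xs pzs′)) ⟩
    xs ++ ys                                          ∎
    where
    open ≡-Reasoning
    P? = T? ∘ p
    pzs′ : All (T ∘ p) (xs ++ ys)
    pzs′ = All.map (λ e → subst T (sym e) _) pzs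
    kept : filterᵇ p xs ≡ xs
    kept = filter-all P? (All.++⁻ˡ xs pzs′)
    dropped : filterᵇ p b ≡ []
    dropped = filter-none P? (All.map (λ e t → subst T e t) ¬pb)

Stats : Set
Stats = ℕ × ℕ × ℕ

-- For a signed permutation of [n], or a σ ∈ Q⁽⁰⁾ₙ₊₁, with statistics s, H n F s is the sum of F over
-- the statistics of its 2n+2 children (∑-childrenB, ∑-childrenQ).
H : ℕ → (Stats → ℕ) → Stats → ℕ
H n F (a , b , c) = if ⌊ b ℕ.≟ a ⌋
  then F (suc a , a , c) + (a * (F (a , a , c) + F (a , a , suc c)) + ((n ∸ a) * F (suc a , suc a , c) + (suc n ∸ a) * F (suc a , suc a , suc c)))
  else a * F (a , b , c) + ((a ∸ 1) * F (a , b , suc c) + ((suc n ∸ a) * (F (suc a , suc b , c) + F (suc a , suc b , suc c)) + F (a , a , suc c)))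

H-diag : (E a c : ℕ) (F : Stats → ℕ) →
  H (E + a) F (a , a , c)
    ≡ F (suc a , a , c) + (a * (F (a , a , c) + F (a , a , suc c)) + (E * F (suc a , suc a , c) + suc E * F (suc a , suc a , suc c)))
H-diag E a c F rewrite ⌊⌋-true (a ℕ.≟ a) refl | m+n∸n≡m E a | 1+m+n∸n≡1+m E a = refl

H-below : (E b c : ℕ) (F : Stats → ℕ) →
  H (E + b) F (suc b , b , c)
    ≡ suc b * F (suc b , b , c) + (b * F (suc b , b , suc c)
        + (E * (F (suc (suc b) , suc b , c) + F (suc (suc b) , suc b , suc c)) + F (suc b , suc b , suc c)))
H-below E b c F rewrite ⌊⌋-false (b ℕ.≟ suc b) (<⇒≢ (n<1+n b)) | m+n∸n≡m E b = refl

descents : ℤ → List ℤ → ℕ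
descents c []      = 0
descents c (y ∷ r) = 𝟙 ⌊ y ℤ.<? c ⌋ + descents y r

descents≤length : (c : ℤ) (r : List ℤ) → descents c r ≤ length r
descents≤length c []      = z≤n
descents≤length c (y ∷ r) with y ℤ.<? c
... | yes _ = s≤s (descents≤length y r)
... | no  _ = m≤n⇒m≤1+n (descents≤length y r)

descents-nth : (c : ℤ) (r : List ℤ) →
  ∑ (upTo (length r)) (λ j → 𝟙 ⌊ nth (ℤ.+ 0) r j ℤ.<? nth (ℤ.+ 0) (c ∷ r) j ⌋) ≡ descents c r
descents-nth c []      = refl
descents-nth c (y ∷ r) = trans (∑-upTo-suc (length r) _) (cong (𝟙 ⌊ y ℤ.<? c ⌋ +_) (descents-nth y r))

desA-∷ : (x : ℤ) (r : List ℤ) → desA (suc (length r)) (x ∷ r) ≡ descents x r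
desA-∷ x r = begin
  desA (suc (length r)) (x ∷ r)       ≡⟨ countᵇ≡∑ _ (map suc (upTo (length r))) ⟩
  ∑ (map suc (upTo (length r))) _     ≡⟨ ∑-map suc (upTo (length r)) _ ⟩
  ∑ (upTo (length r)) _               ≡⟨ descents-nth x r ⟩
  descents x r                        ∎
  where open ≡-Reasoning

desB-∷ : (x : ℤ) (r : List ℤ) → desB (suc (length r)) (x ∷ r) ≡ descents (ℤ.+ 0) (x ∷ r)
desB-∷ x r = begin
  desB (suc (length r)) (x ∷ r)       ≡⟨ countᵇ≡∑ _ (map (0 +_) (upTo (suc (length r)))) ⟩
  ∑ (map (0 +_) (upTo (suc (length r)))) _
                                      ≡⟨ ∑-map (0 +_) (upTo (suc (length r))) _ ⟩
  ∑ (upTo (suc (length r))) _         ≡⟨ ∑-cong (upTo (suc (length r))) (λ {j} _ →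
                                           cong (λ z → 𝟙 ⌊ nth (ℤ.+ 0) (x ∷ r) j ℤ.<? z ⌋) (at≡nth (ℤ.+ 0) (x ∷ r) j)) ⟩
  ∑ (upTo (suc (length r))) _         ≡⟨ descents-nth (ℤ.+ 0) (x ∷ r) ⟩
  descents (ℤ.+ 0) (x ∷ r)            ∎
  where open ≡-Reasoning

isNeg : ℤ → Bool
isNeg e = ⌊ e ℤ.<? ℤ.+ 0 ⌋

statB : ℕ → List ℤ → Stats
statB n π = suc (desA n π) , desB n π , neg π

statB-∷ : (x : ℤ) (w : List ℤ) →
  statB (suc (length w)) (x ∷ w) ≡ (suc (descents x w) , 𝟙 (isNeg x) + descents x w , 𝟙 (isNeg x) + ∑ w (𝟙 ∘ isNeg))
statB-∷ x w = cong₂ _,_ (cong suc (desA-∷ x w)) (cong₂ _,_ (desB-∷ x w) (countᵇ≡∑ isNeg (x ∷ w)))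

<⇒<?-false : {a b : ℤ} → a ℤ.< b → ⌊ b ℤ.<? a ⌋ ≡ false
<⇒<?-false {a} {b} a<b = ⌊⌋-false (b ℤ.<? a) (ℤ.<-asym a<b)

-- A new maximum inserted into a descent or at the end keeps the number of descents and inserted
-- into any other gap adds one; a new minimum keeps it only when inserted into a descent.
∑-insert-max : (c v : ℤ) (r : List ℤ) → All (ℤ._< v) (c ∷ r) → (G : ℕ → ℕ) →
  ∑ (insertions [ v ] r) (G ∘ descents c)
    ≡ suc (descents c r) * G (descents c r) + (length r ∸ descents c r) * G (suc (descents c r))
∑-insert-max c v []      (c<v ∷ [])         G rewrite <⇒<?-false c<v = sym (+-identityʳ (G 0 + 0))
∑-insert-max c v (y ∷ r) (c<v ∷ y<v ∷ r<v) G = begin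
  ∑ (insertions [ v ] (y ∷ r)) (G ∘ descents c)
    ≡⟨ cong₂ _+_ (cong G front) (∑-map (y ∷_) (insertions [ v ] r) (G ∘ descents c)) ⟩
  G (suc D) + ∑ (insertions [ v ] r) (G ∘ (t +_) ∘ descents y)
    ≡⟨ cong (G (suc D) +_) (∑-insert-max y v r (y<v ∷ r<v) (G ∘ (t +_))) ⟩
  G (suc D) + (suc D * G (t + D) + (length r ∸ D) * G (t + suc D))
    ≡⟨ step ⌊ y ℤ.<? c ⌋ ⟩
  suc (t + D) * G (t + D) + (suc (length r) ∸ (t + D)) * G (suc (t + D))
    ∎
  where
  open ≡-Reasoning
  D = descents y r
  t = 𝟙 ⌊ y ℤ.<? c ⌋
  front : 𝟙 ⌊ v ℤ.<? c ⌋ + (𝟙 ⌊ y ℤ.<? v ⌋ + D) ≡ suc D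
  front rewrite <⇒<?-false c<v | ⌊⌋-true (y ℤ.<? v) y<v = refl
  step : (b : Bool) →
    G (suc D) + (suc D * G (𝟙 b + D) + (length r ∸ D) * G (𝟙 b + suc D))
      ≡ suc (𝟙 b + D) * G (𝟙 b + D) + (suc (length r) ∸ (𝟙 b + D)) * G (suc (𝟙 b + D))
  step true  = sym (+-assoc (G (suc D)) (suc D * G (suc D)) ((length r ∸ D) * G (suc (suc D))))
  step false rewrite +-∸-assoc 1 (descents≤length y r) = +-exchange (G (suc D)) (suc D * G D) ((length r ∸ D) * G (suc D))

∑-insert-min : (c v : ℤ) (r : List ℤ) → All (v ℤ.<_) (c ∷ r) → (G : ℕ → ℕ) →
  ∑ (insertions [ v ] r) (G ∘ descents c)
    ≡ descents c r * G (descents c r) + suc (length r ∸ descents c r) * G (suc (descents c r))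
∑-insert-min c v []      (v<c ∷ [])         G rewrite ⌊⌋-true (v ℤ.<? c) v<c = refl
∑-insert-min c v (y ∷ r) (v<c ∷ v<y ∷ v<r) G = begin
  ∑ (insertions [ v ] (y ∷ r)) (G ∘ descents c)
    ≡⟨ cong₂ _+_ (cong G front) (∑-map (y ∷_) (insertions [ v ] r) (G ∘ descents c)) ⟩
  G (suc D) + ∑ (insertions [ v ] r) (G ∘ (t +_) ∘ descents y)
    ≡⟨ cong (G (suc D) +_) (∑-insert-min y v r (v<y ∷ v<r) (G ∘ (t +_))) ⟩
  G (suc D) + (D * G (t + D) + suc (length r ∸ D) * G (t + suc D))
    ≡⟨ step ⌊ y ℤ.<? c ⌋ ⟩
  (t + D) * G (t + D) + suc (suc (length r) ∸ (t + D)) * G (suc (t + D))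
    ∎
  where
  open ≡-Reasoning
  D = descents y r
  t = 𝟙 ⌊ y ℤ.<? c ⌋
  front : 𝟙 ⌊ v ℤ.<? c ⌋ + (𝟙 ⌊ y ℤ.<? v ⌋ + D) ≡ suc D
  front rewrite ⌊⌋-true (v ℤ.<? c) v<c | <⇒<?-false v<y = refl
  step : (b : Bool) →
    G (suc D) + (D * G (𝟙 b + D) + suc (length r ∸ D) * G (𝟙 b + suc D))
      ≡ (𝟙 b + D) * G (𝟙 b + D) + suc (suc (length r) ∸ (𝟙 b + D)) * G (suc (𝟙 b + D))
  step true  = sym (+-assoc (G (suc D)) (D * G (suc D)) (suc (length r ∸ D) * G (suc (suc D))))
  step false rewrite +-∸-assoc 1 (descents≤length y r) =
    +-exchange (G (suc D)) (D * G D) (suc (length r ∸ D) * G (suc D))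

childrenB : ℕ → List ℤ → List (List ℤ)
childrenB n π = insertions [ ℤ.+ suc n ] π ++ insertions [ -[1+ n ] ] π

∑-statB-insertions : (x v : ℤ) (r : List ℤ) (F : Stats → ℕ) →
  ∑ (insertions [ v ] (x ∷ r)) (F ∘ statB (suc (suc (length r))))
    ≡ F (statB (suc (suc (length r))) (v ∷ x ∷ r))
      + ∑ (insertions [ v ] r) (λ w → F (suc (descents x w) , 𝟙 (isNeg x) + descents x w , 𝟙 (isNeg x) + (∑ [ v ] (𝟙 ∘ isNeg) + ∑ r (𝟙 ∘ isNeg))))
∑-statB-insertions x v r F =
  cong (F (statB (suc (suc (length r))) (v ∷ x ∷ r)) +_)
       (trans (∑-map (x ∷_) (insertions [ v ] r) _) (∑-cong (insertions [ v ] r) (cong F ∘ statB-x∷w)))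
  where
  statB-x∷w : ∀ {w} → w ∈ insertions [ v ] r →
    statB (suc (suc (length r))) (x ∷ w)
      ≡ (suc (descents x w) , 𝟙 (isNeg x) + descents x w , 𝟙 (isNeg x) + (∑ [ v ] (𝟙 ∘ isNeg) + ∑ r (𝟙 ∘ isNeg)))
  statB-x∷w {w} w∈ = begin
    statB (suc (suc (length r))) (x ∷ w) ≡⟨ cong (λ k → statB (suc k) (x ∷ w)) (length-insertions [ v ] r w∈) ⟨
    statB (suc (length w)) (x ∷ w)       ≡⟨ statB-∷ x w ⟩
    _                                    ≡⟨ cong (λ k → suc (descents x w) , 𝟙 (isNeg x) + descents x w , 𝟙 (isNeg x) + k)
                                                 (∑-insertions [ v ] r w∈ (𝟙 ∘ isNeg)) ⟩
    _                                    ∎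
    where open ≡-Reasoning

H-signed : (b : Bool) (D L N : ℕ) → D ≤ L → (F : Stats → ℕ) →
  (F (suc (suc D) , suc D , 𝟙 b + N)
     + (suc D * F (suc D , 𝟙 b + D , 𝟙 b + N) + (L ∸ D) * F (suc (suc D) , 𝟙 b + suc D , 𝟙 b + N)))
  + (F (suc D , suc D , suc (𝟙 b + N))
     + (D * F (suc D , 𝟙 b + D , 𝟙 b + suc N) + suc (L ∸ D) * F (suc (suc D) , 𝟙 b + suc D , 𝟙 b + suc N)))
  ≡ H (suc L) F (suc D , 𝟙 b + D , 𝟙 b + N)
H-signed true D L N D≤L F = begin
  _ ≡⟨ normalise (F (suc (suc D) , suc D , suc N)) (F (suc D , suc D , suc N)) (F (suc (suc D) , suc (suc D) , suc N))
                 (F (suc D , suc D , suc (suc N))) (F (suc (suc D) , suc (suc D) , suc (suc N))) D (L ∸ D) ⟩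
  _ ≡⟨ H-diag (L ∸ D) (suc D) (suc N) F ⟨
  H (L ∸ D + suc D) F (suc D , suc D , suc N)
    ≡⟨ cong (λ n → H n F (suc D , suc D , suc N)) (trans (+-suc (L ∸ D) D) (cong suc (m∸n+n≡m D≤L))) ⟩
  H (suc L) F (suc D , suc D , suc N) ∎
  where
  open ≡-Reasoning
  normalise : ∀ f₀ f₁ f₂ f₃ f₄ D e →
    (f₀ + ((1 + D) * f₁ + e * f₂)) + (f₃ + (D * f₃ + (1 + e) * f₄))
      ≡ f₀ + ((1 + D) * (f₁ + f₃) + (e * f₂ + (1 + e) * f₄))
  normalise = solve-∀
H-signed false D L N D≤L F = begin
  _ ≡⟨ normalise (F (suc (suc D) , suc D , N)) (F (suc D , D , N)) (F (suc (suc D) , suc D , suc N))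
                 (F (suc D , D , suc N)) (F (suc D , suc D , suc N)) D (L ∸ D) ⟩
  _ ≡⟨ H-below (suc (L ∸ D)) D N F ⟨
  H (suc (L ∸ D) + D) F (suc D , D , N) ≡⟨ cong (λ n → H n F (suc D , D , N)) (cong suc (m∸n+n≡m D≤L)) ⟩
  H (suc L) F (suc D , D , N) ∎
  where
  open ≡-Reasoning
  normalise : ∀ f₀ f₁ f₂ f₃ f₄ D e →
    (f₀ + ((1 + D) * f₁ + e * f₀)) + (f₄ + (D * f₃ + (1 + e) * f₂))
      ≡ (1 + D) * f₁ + (D * f₃ + ((1 + e) * (f₀ + f₂) + f₄))
  normalise = solve-∀

∑-childrenB : (x : ℤ) (r : List ℤ) → All (ℤ._< ℤ.+ suc (suc (length r))) (x ∷ r) →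
  All (-[1+ suc (length r) ] ℤ.<_) (x ∷ r) → (F : Stats → ℕ) →
  ∑ (childrenB (suc (length r)) (x ∷ r)) (F ∘ statB (suc (suc (length r))))
    ≡ H (suc (length r)) F (statB (suc (length r)) (x ∷ r))
∑-childrenB x r below above@(v<x ∷ _) F = begin
  ∑ (childrenB (suc L) (x ∷ r)) (F ∘ statB (suc (suc L)))
    ≡⟨ ∑-++ (insertions [ v₊ ] (x ∷ r)) (insertions [ v₋ ] (x ∷ r)) _ ⟩
  ∑ (insertions [ v₊ ] (x ∷ r)) (F ∘ statB (suc (suc L))) + ∑ (insertions [ v₋ ] (x ∷ r)) (F ∘ statB (suc (suc L)))
    ≡⟨ cong₂ _+_ (∑-statB-insertions x v₊ r F) (∑-statB-insertions x v₋ r F) ⟩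
  (F (statB (suc (suc L)) (v₊ ∷ x ∷ r)) + ∑ (insertions [ v₊ ] r) (G 0 ∘ descents x))
    + (F (statB (suc (suc L)) (v₋ ∷ x ∷ r)) + ∑ (insertions [ v₋ ] r) (G 1 ∘ descents x))
    ≡⟨ cong₂ _+_ (cong₂ _+_ (cong F (trans (statB-∷ v₊ (x ∷ r)) (cong (λ d → suc d , d , s + N) front₊)))
                            (∑-insert-max x v₊ r below (G 0)))
                 (cong₂ _+_ (cong F (trans (statB-∷ v₋ (x ∷ r)) (cong (λ d → suc d , suc d , suc (s + N)) front₋)))
                            (∑-insert-min x v₋ r above (G 1))) ⟩
  (F (suc (suc D) , suc D , s + N) + (suc D * G 0 D + (L ∸ D) * G 0 (suc D)))
    + (F (suc D , suc D , suc (s + N)) + (D * G 1 D + suc (L ∸ D) * G 1 (suc D)))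
    ≡⟨ H-signed (isNeg x) D L N (descents≤length x r) F ⟩
  H (suc L) F (suc D , s + D , s + N)
    ≡⟨ cong (H (suc L) F) (statB-∷ x r) ⟨
  H (suc L) F (statB (suc L) (x ∷ r))
    ∎
  where
  open ≡-Reasoning
  L = length r
  D = descents x r
  N = ∑ r (𝟙 ∘ isNeg)
  s = 𝟙 (isNeg x)
  v₊ = ℤ.+ suc (suc L)
  v₋ = -[1+ suc L ]
  G : ℕ → ℕ → ℕ
  G k a = F (suc a , s + a , s + (k + N))
  front₊ : descents v₊ (x ∷ r) ≡ suc D
  front₊ rewrite ⌊⌋-true (x ℤ.<? v₊) (All.head below) = refl
  front₋ : descents v₋ (x ∷ r) ≡ D
  front₋ rewrite <⇒<?-false v<x = refl

SignedLetter : ℕ → ℤ → Set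
SignedLetter n e = ∃[ k ] k < n × (e ≡ ℤ.+ suc k ⊎ e ≡ -[1+ k ])

∣∣-signed : {k : ℕ} {e : ℤ} → e ≡ ℤ.+ suc k ⊎ e ≡ -[1+ k ] → ∣ e ∣ ≡ suc k
∣∣-signed (inj₁ refl) = refl
∣∣-signed (inj₂ refl) = refl

∈-signedAlphabet⁻ : (n : ℕ) {e : ℤ} → e ∈ signedAlphabet n → SignedLetter n e
∈-signedAlphabet⁻ n e∈ with ∈-++⁻ (map ℤ.+_ (range 1 n)) e∈
... | inj₁ e∈₊ with _ , j∈ , refl ← ∈-map⁻ ℤ.+_ e∈₊ with k , k∈ , refl ← ∈-map⁻ suc j∈ = k , ∈-upTo⁻ k∈ , inj₁ refl
... | inj₂ e∈₋ with _ , j∈ , refl ← ∈-map⁻ _ e∈₋ with k , k∈ , refl ← ∈-map⁻ suc j∈ = k , ∈-upTo⁻ k∈ , inj₂ refl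

∈-signedAlphabet⁺ : (n : ℕ) {e : ℤ} → SignedLetter n e → e ∈ signedAlphabet n
∈-signedAlphabet⁺ n (k , k<n , inj₁ refl) = ∈-++⁺ˡ (∈-map⁺ ℤ.+_ (∈-map⁺ suc (∈-upTo⁺ k<n)))
∈-signedAlphabet⁺ n (k , k<n , inj₂ refl) = ∈-++⁺ʳ (map ℤ.+_ (range 1 n)) (∈-map⁺ _ (∈-map⁺ suc (∈-upTo⁺ k<n)))

signedAlphabet-unique : (n : ℕ) → Unique (signedAlphabet n)
signedAlphabet-unique n =
  Unique.++⁺ (Unique.map⁺ ℤ.+-injective range-unique)
             (Unique.map⁺ (ℤ.+-injective ∘ ℤ.neg-injective) range-unique)
             signs-differ
  where
  range-unique : Unique (range 1 n)
  range-unique = Unique.map⁺ suc-injective (Unique.upTo⁺ n)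
  signs-differ : ∀ {e} → ¬ (e ∈ map ℤ.+_ (range 1 n) × e ∈ map (λ k → ℤ.- (ℤ.+ k)) (range 1 n))
  signs-differ (e∈₊ , e∈₋)
    with _ , _ , refl ← ∈-map⁻ ℤ.+_ e∈₊
    with _ , j∈ , e≡ ← ∈-map⁻ _ e∈₋
    with _ , _ , refl ← ∈-map⁻ suc j∈
    with () ← e≡

hasAbs : ℕ → ℤ → Bool
hasAbs j e = ⌊ ∣ e ∣ ℕ.≟ j ⌋

record IsSignedPerm (n : ℕ) (π : List ℤ) : Set where
  field
    length≡ : length π ≡ n
    letters : All (SignedLetter n) π
    once    : ∀ {k} → k < n → ∑ π (𝟙 ∘ hasAbs (suc k)) ≡ 1

∈SB⁻ : (n : ℕ) {π : List ℤ} → π ∈ SB n → IsSignedPerm n π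
∈SB⁻ n {π} π∈ with π∈words , isPerm ← ∈-filterᵇ⁻ (isSignedPerm n) π∈
              with len , inAlphabet ← ∈-words⁻ n (signedAlphabet n) π∈words = record
  { length≡ = len
  ; letters = All.map (∈-signedAlphabet⁻ n) inAlphabet
  ; once    = λ {k} k<n → trans (sym (countᵇ≡∑ (hasAbs (suc k)) π))
                            (toWitness (allᵇ⁻ _ isPerm (∈-map⁺ suc (∈-upTo⁺ k<n))))
  }

∈SB⁺ : (n : ℕ) {π : List ℤ} → IsSignedPerm n π → π ∈ SB n
∈SB⁺ n {π} perm = ∈-filterᵇ⁺ (isSignedPerm n)
  (∈-words⁺ n (signedAlphabet n) length≡ (All.map (∈-signedAlphabet⁺ n) letters))
  (allᵇ⁺ _ λ j∈ → once-at (∈-map⁻ suc j∈))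
  where
  open IsSignedPerm perm
  once-at : ∀ {j} → ∃[ k ] k ∈ upTo n × j ≡ suc k → T ⌊ countᵇ (hasAbs j) π ℕ.≟ 1 ⌋
  once-at (k , k∈ , refl) = fromWitness (trans (countᵇ≡∑ (hasAbs (suc k)) π) (once (∈-upTo⁻ k∈)))

SignedLetter-weaken : {n : ℕ} {e : ℤ} → SignedLetter n e → SignedLetter (suc n) e
SignedLetter-weaken (k , k<n , e≡) = k , m≤n⇒m≤1+n k<n , e≡

hasAbs-SignedLetter : {n : ℕ} {e : ℤ} → SignedLetter n e → hasAbs (suc n) e ≡ false
hasAbs-SignedLetter {n} {e} (k , k<n , e≡) =
  ⌊⌋-false (∣ e ∣ ℕ.≟ suc n) (λ ∣e∣≡ → <-irrefl (suc-injective (trans (sym (∣∣-signed e≡)) ∣e∣≡)) k<n)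

SignedLetter-strengthen : {n : ℕ} {e : ℤ} → SignedLetter (suc n) e → hasAbs (suc n) e ≡ false → SignedLetter n e
SignedLetter-strengthen (k , k<1+n , e≡) ∣e∣≢ with m<1+n⇒m<n∨m≡n k<1+n
... | inj₁ k<n  = k , k<n , e≡
... | inj₂ refl with () ← trans (sym (⌊⌋-true (_ ℕ.≟ _) (∣∣-signed e≡))) ∣e∣≢

SignedLetter-fresh : (n : ℕ) {v : ℤ} → ∣ v ∣ ≡ suc n → SignedLetter (suc n) v
SignedLetter-fresh n {ℤ.+ _}    refl = n , n<1+n n , inj₁ refl
SignedLetter-fresh n { -[1+ _ ]} refl = n , n<1+n n , inj₂ refl

fresh≢SignedLetter : {n : ℕ} {v e : ℤ} → ∣ v ∣ ≡ suc n → SignedLetter n e → v ≢ e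
fresh≢SignedLetter {n} {v} ∣v∣≡ l refl with () ← trans (sym (⌊⌋-true (∣ v ∣ ℕ.≟ suc n) ∣v∣≡)) (hasAbs-SignedLetter l)

eraseB : ℕ → List ℤ → List ℤ
eraseB n = filterᵇ (not ∘ hasAbs (suc n))

module _ {n : ℕ} {v : ℤ} (∣v∣≡ : ∣ v ∣ ≡ suc n) {π w : List ℤ} (w∈ : w ∈ insertions [ v ] π) where

  private
    fresh-avoids : ∀ {k} → k < n → hasAbs (suc k) v ≡ false
    fresh-avoids {k} k<n = ⌊⌋-false (∣ v ∣ ℕ.≟ suc k) (λ eq → <-irrefl (sym (suc-injective (trans (sym ∣v∣≡) eq))) k<n)

  IsSignedPerm-insert : IsSignedPerm n π → IsSignedPerm (suc n) w
  IsSignedPerm-insert perm = record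
    { length≡ = trans (length-insertions [ v ] π w∈) (cong suc length≡)
    ; letters = All-insertions [ v ] π w∈ (SignedLetter-fresh n ∣v∣≡ ∷ []) (All.map SignedLetter-weaken letters)
    ; once    = λ k<1+n → trans (∑-insertions [ v ] π w∈ (𝟙 ∘ hasAbs _)) (count k<1+n)
    }
    where
    open IsSignedPerm perm
    count : ∀ {k} → k < suc n → 𝟙 (hasAbs (suc k) v) + 0 + ∑ π (𝟙 ∘ hasAbs (suc k)) ≡ 1
    count {k} k<1+n with m<1+n⇒m<n∨m≡n k<1+n
    ... | inj₁ k<n  rewrite fresh-avoids k<n = once k<n
    ... | inj₂ refl rewrite ⌊⌋-true (∣ v ∣ ℕ.≟ suc k) ∣v∣≡ =
      cong suc (All⇒∑𝟙≡0 (hasAbs (suc k)) (All.map hasAbs-SignedLetter letters))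

  eraseB-insertion : IsSignedPerm n π → eraseB n w ≡ π
  eraseB-insertion perm = filterᵇ-insertions [ v ] π w∈ (not ∘ hasAbs (suc n))
    (cong not (⌊⌋-true (∣ v ∣ ℕ.≟ suc n) ∣v∣≡) ∷ []) (All.map (cong not ∘ hasAbs-SignedLetter) (IsSignedPerm.letters perm))

  IsSignedPerm-remove : All (λ e → hasAbs (suc n) e ≡ false) π → IsSignedPerm (suc n) w → IsSignedPerm n π
  IsSignedPerm-remove others perm = record
    { length≡ = suc-injective (trans (sym (length-insertions [ v ] π w∈)) length≡)
    ; letters = All.zipWith (λ (l , ∣e∣≢) → SignedLetter-strengthen l ∣e∣≢)
                  (All-insertions⁻ [ v ] π w∈ letters , others)
    ; once    = λ {k} k<n → trans (sym (count k<n))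
                              (trans (sym (∑-insertions [ v ] π w∈ (𝟙 ∘ hasAbs (suc k)))) (once (m≤n⇒m≤1+n k<n)))
    }
    where
    open IsSignedPerm perm
    count : ∀ {k} → k < n → 𝟙 (hasAbs (suc k) v) + 0 + ∑ π (𝟙 ∘ hasAbs (suc k)) ≡ ∑ π (𝟙 ∘ hasAbs (suc k))
    count k<n rewrite fresh-avoids k<n = refl

childrenB⊆SB : (n : ℕ) {π w : List ℤ} → π ∈ SB n → w ∈ childrenB n π → w ∈ SB (suc n)
childrenB⊆SB n {π} π∈ w∈ with ∈-++⁻ (insertions [ ℤ.+ suc n ] π) w∈
... | inj₁ w∈₊ = ∈SB⁺ (suc n) (IsSignedPerm-insert refl w∈₊ (∈SB⁻ n π∈))
... | inj₂ w∈₋ = ∈SB⁺ (suc n) (IsSignedPerm-insert refl w∈₋ (∈SB⁻ n π∈))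

parentB : (n : ℕ) {w : List ℤ} → w ∈ SB (suc n) → ∃[ π ] π ∈ SB n × w ∈ childrenB n π
parentB n {w} w∈ with perm ← ∈SB⁻ (suc n) w∈
  with A , v , B , refl , hv , A₀ , B₀ ← split-at-first (hasAbs (suc n)) w (IsSignedPerm.once perm (n<1+n n)) =
  A ++ B , ∈SB⁺ n (IsSignedPerm-remove ∣v∣≡ v∈ others perm) , child (sign v ∣v∣≡)
  where
  ∣v∣≡ : ∣ v ∣ ≡ suc n
  ∣v∣≡ = ⌊⌋-true⁻ (∣ v ∣ ℕ.≟ suc n) hv
  v∈ : A ++ v ∷ B ∈ insertions [ v ] (A ++ B)
  v∈ = ∈-insertions⁺ [ v ] A B
  others : All (λ e → hasAbs (suc n) e ≡ false) (A ++ B)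
  others = ∑𝟙≡0⇒All (hasAbs (suc n)) (A ++ B) (trans (∑-++ A B _) (cong₂ _+_ A₀ B₀))
  sign : (e : ℤ) → ∣ e ∣ ≡ suc n → e ≡ ℤ.+ suc n ⊎ e ≡ -[1+ n ]
  sign (ℤ.+ _)    refl = inj₁ refl
  sign -[1+ _ ] refl = inj₂ refl
  child : v ≡ ℤ.+ suc n ⊎ v ≡ -[1+ n ] → A ++ v ∷ B ∈ childrenB n (A ++ B)
  child (inj₁ refl) = ∈-++⁺ˡ v∈
  child (inj₂ refl) = ∈-++⁺ʳ (insertions [ ℤ.+ suc n ] (A ++ B)) v∈

childrenB-unique : (n : ℕ) {π : List ℤ} → π ∈ SB n → Unique (childrenB n π)
childrenB-unique n {π} π∈ =
  Unique.++⁺ (insertions-unique (ℤ.+ suc n) [] (All.map (fresh≢SignedLetter refl) letters))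
             (insertions-unique -[1+ n ] [] (All.map (fresh≢SignedLetter refl) letters))
             signs-differ
  where
  open IsSignedPerm (∈SB⁻ n π∈)
  signs-differ : ∀ {w} → ¬ (w ∈ insertions [ ℤ.+ suc n ] π × w ∈ insertions [ -[1+ n ] ] π)
  signs-differ (w∈₊ , w∈₋) =
    <⇒≢ (n<1+n _) (trans (sym (∑-insertions [ _ ] π w∈₊ (𝟙 ∘ isNeg))) (∑-insertions [ _ ] π w∈₋ (𝟙 ∘ isNeg)))

eraseB-childrenB : (n : ℕ) {π w : List ℤ} → π ∈ SB n → w ∈ childrenB n π → eraseB n w ≡ π
eraseB-childrenB n {π} π∈ w∈ with ∈-++⁻ (insertions [ ℤ.+ suc n ] π) w∈
... | inj₁ w∈₊ = eraseB-insertion refl w∈₊ (∈SB⁻ n π∈)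
... | inj₂ w∈₋ = eraseB-insertion refl w∈₋ (∈SB⁻ n π∈)

SB-unique : (n : ℕ) → Unique (SB n)
SB-unique n = Unique.filter⁺ (T? ∘ isSignedPerm n) (words-unique n (signedAlphabet-unique n))

SB-step : (n : ℕ) → SB (suc n) ↭ concatMap (childrenB n) (SB n)
SB-step n = ↭-concatMap-children (childrenB n) (eraseB n) (SB-unique n) (SB-unique (suc n))
  (childrenB-unique n) (eraseB-childrenB n) (childrenB⊆SB n) (parentB n)

SignedLetter-below : {n : ℕ} {e : ℤ} → SignedLetter n e → e ℤ.< ℤ.+ suc n
SignedLetter-below (k , k<n , inj₁ refl) = +<+ (s≤s k<n)
SignedLetter-below (k , k<n , inj₂ refl) = -<+

SignedLetter-above : {n : ℕ} {e : ℤ} → SignedLetter n e → -[1+ n ] ℤ.< e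
SignedLetter-above (k , k<n , inj₁ refl) = -<+
SignedLetter-above (k , k<n , inj₂ refl) = -<- k<n

∑-childrenB-IsSignedPerm : {n : ℕ} {π : List ℤ} → IsSignedPerm (suc n) π → (F : Stats → ℕ) →
  ∑ (childrenB (suc n) π) (F ∘ statB (suc (suc n))) ≡ H (suc n) F (statB (suc n) π)
∑-childrenB-IsSignedPerm {π = x ∷ r} record { length≡ = refl ; letters = letters } =
  ∑-childrenB x r (All.map SignedLetter-below letters) (All.map SignedLetter-above letters)

∑-SB-step : (n : ℕ) (F : Stats → ℕ) →
  ∑ (SB (suc (suc n))) (F ∘ statB (suc (suc n))) ≡ ∑ (SB (suc n)) (H (suc n) F ∘ statB (suc n))
∑-SB-step n F = begin
  ∑ (SB (suc (suc n))) (F ∘ statB (suc (suc n)))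
    ≡⟨ ∑-↭ _ (SB-step (suc n)) ⟩
  ∑ (concatMap (childrenB (suc n)) (SB (suc n))) (F ∘ statB (suc (suc n)))
    ≡⟨ ∑-concatMap (childrenB (suc n)) (SB (suc n)) _ ⟩
  ∑ (SB (suc n)) (λ π → ∑ (childrenB (suc n) π) (F ∘ statB (suc (suc n))))
    ≡⟨ ∑-cong (SB (suc n)) (λ π∈ → ∑-childrenB-IsSignedPerm (∈SB⁻ (suc n) π∈) F) ⟩
  ∑ (SB (suc n)) (H (suc n) F ∘ statB (suc n))
    ∎
  where open ≡-Reasoning

plateau? : ℕ → ℕ → List ℕ → Bool
plateau? a b []      = false
plateau? a b (z ∷ _) = ⌊ a ℕ.<? b ⌋ ∧ ⌊ b ℕ.≟ z ⌋

plateaus : ℕ → ℕ → List ℕ → ℕ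
plateaus a b []      = 0
plateaus a b (z ∷ r) = 𝟙 (plateau? a b (z ∷ r)) + plateaus b z r

laterPlateaus : ℕ → List ℕ → ℕ
laterPlateaus b []      = 0
laterPlateaus b (z ∷ r) = plateaus b z r

plateaus-split : (a b : ℕ) (u : List ℕ) → plateaus a b u ≡ 𝟙 (plateau? a b u) + laterPlateaus b u
plateaus-split a b []      = refl
plateaus-split a b (z ∷ u) = refl

plateaus-after-max : {m z : ℕ} (u : List ℕ) → z < m → plateaus m z u ≡ laterPlateaus z u
plateaus-after-max []      z<m = refl
plateaus-after-max {m} {z} (y ∷ u) z<m rewrite ⌊⌋-false (m ℕ.<? z) (<⇒≱ (m≤n⇒m≤1+n z<m)) = refl

plateau-nth : List ℕ → ℕ → Bool
plateau-nth u j = ⌊ nth 0 u j ℕ.<? nth 0 u (suc j) ⌋ ∧ ⌊ nth 0 u (suc j) ℕ.≟ nth 0 u (suc (suc j)) ⌋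

plateaus-nth : (a b : ℕ) (r : List ℕ) → ∑ (upTo (length r)) (𝟙 ∘ plateau-nth (a ∷ b ∷ r)) ≡ plateaus a b r
plateaus-nth a b []      = refl
plateaus-nth a b (z ∷ r) = trans (∑-upTo-suc (length r) _) (cong (𝟙 (plateau? a b (z ∷ r)) +_) (plateaus-nth b z r))

lap-∷ : (n x : ℕ) (r : List ℕ) → length r ≡ 2 * n → lap n (x ∷ r) ≡ plateaus 0 x r
lap-∷ n x r len = begin
  lap n (x ∷ r)                                       ≡⟨ countᵇ≡∑ _ (map suc (upTo (2 * n))) ⟩
  ∑ (map suc (upTo (2 * n))) _                        ≡⟨ ∑-map suc (upTo (2 * n)) _ ⟩
  ∑ (upTo (2 * n)) _                                  ≡⟨ ∑-cong (upTo (2 * n)) (λ {j} _ →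
    cong (λ a → 𝟙 (⌊ a ℕ.<? nth 0 (x ∷ r) j ⌋ ∧ ⌊ nth 0 (x ∷ r) j ℕ.≟ nth 0 r j ⌋)) (at≡nth 0 (x ∷ r) j)) ⟩
  ∑ (upTo (2 * n)) (𝟙 ∘ plateau-nth (0 ∷ x ∷ r))      ≡⟨ cong (λ k → ∑ (upTo k) (𝟙 ∘ plateau-nth (0 ∷ x ∷ r))) len ⟨
  ∑ (upTo (length r)) (𝟙 ∘ plateau-nth (0 ∷ x ∷ r))   ≡⟨ plateaus-nth 0 x r ⟩
  plateaus 0 x r                                      ∎
  where open ≡-Reasoning

ap-∷ : (n x y : ℕ) (r : List ℕ) → 2 * n ≡ suc (length r) → ap n (x ∷ y ∷ r) ≡ plateaus x y r
ap-∷ n x y r len = begin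
  ap n (x ∷ y ∷ r)                                    ≡⟨ cong (λ k → countᵇ (plateauAt (x ∷ y ∷ r)) (range 2 k)) len ⟩
  countᵇ _ (map (2 +_) (upTo (length r)))             ≡⟨ countᵇ≡∑ _ (map (2 +_) (upTo (length r))) ⟩
  ∑ (map (2 +_) (upTo (length r))) _                  ≡⟨ ∑-map (2 +_) (upTo (length r)) _ ⟩
  ∑ (upTo (length r)) (𝟙 ∘ plateau-nth (x ∷ y ∷ r))   ≡⟨ plateaus-nth x y r ⟩
  plateaus x y r                                      ∎
  where open ≡-Reasoning

isEven-suc : (k : ℕ) → isEven (suc k) ≡ not (isEven k)
isEven-suc zero          = refl
isEven-suc (suc zero)    = refl
isEven-suc (suc (suc k)) = isEven-suc k

isEven-firstPos-insertions : {v m : ℕ} → v ≢ m → {σ w : List ℕ} → w ∈ insertions (m ∷ m ∷ []) σ →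
  isEven (firstPos v w) ≡ isEven (firstPos v σ)
isEven-firstPos-insertions {v} {m} v≢m {σ} w∈ with A , B , refl , refl ← ∈-insertions⁻ (m ∷ m ∷ []) σ w∈ = shift A
  where
  shift : (A : List ℕ) → isEven (firstPos v (A ++ m ∷ m ∷ B)) ≡ isEven (firstPos v (A ++ B))
  shift []      rewrite ⌊⌋-false (m ℕ.≟ v) (v≢m ∘ sym) = refl
  shift (a ∷ A) with a ℕ.≟ v
  ... | yes _ = refl
  ... | no  _ rewrite isEven-suc (firstPos v (A ++ m ∷ m ∷ B)) | isEven-suc (firstPos v (A ++ B)) = cong not (shift A)

even-insertions : (n : ℕ) {σ w : List ℕ} → w ∈ insertions (suc (suc n) ∷ suc (suc n) ∷ []) σ →
  even (suc n) w ≡ 𝟙 (isEven (firstPos (suc (suc n)) w)) + even n σ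
even-insertions n {σ} {w} w∈ = begin
  even (suc n) w
    ≡⟨ countᵇ≡∑ _ (map (2 +_) (upTo (suc n))) ⟩
  ∑ (map (2 +_) (upTo (suc n))) (𝟙 ∘ parity w)
    ≡⟨ ∑-map (2 +_) (upTo (suc n)) _ ⟩
  ∑ (upTo (suc n)) (𝟙 ∘ parity w ∘ (2 +_))
    ≡⟨ ∑-upTo-∷ʳ n _ ⟩
  𝟙 (parity w (2 + n)) + ∑ (upTo n) (𝟙 ∘ parity w ∘ (2 +_))
    ≡⟨ cong (𝟙 (parity w (2 + n)) +_) (∑-cong (upTo n) (λ k∈ → cong 𝟙 (isEven-firstPos-insertions (small k∈) w∈))) ⟩
  𝟙 (parity w (2 + n)) + ∑ (upTo n) (𝟙 ∘ parity σ ∘ (2 +_))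
    ≡⟨ cong (𝟙 (parity w (2 + n)) +_) (trans (countᵇ≡∑ _ (map (2 +_) (upTo n))) (∑-map (2 +_) (upTo n) _)) ⟨
  𝟙 (parity w (2 + n)) + even n σ
    ∎
  where
  open ≡-Reasoning
  parity : List ℕ → ℕ → Bool
  parity u v = isEven (firstPos v u)
  small : ∀ {k} → k ∈ upTo n → 2 + k ≢ 2 + n
  small k∈ eq = <⇒≢ (∈-upTo⁻ k∈) (suc-injective (suc-injective eq))

evens≤ odds≤ : ℕ → ℕ
evens≤ zero    = 1
evens≤ (suc L) = suc (odds≤ L)
odds≤ zero    = 0
odds≤ (suc L) = evens≤ L

plateauShape : Bool → ℕ → ℕ → ℕ → ℕ → (ℕ × Bool → ℕ) → ℕ
plateauShape t P Q E O G =
  𝟙 t * G (P , false) + (Q * (G (P , false) + G (P , true)) + (E * G (suc P , false) + O * G (suc P , true)))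

-- Putting m m right after the k-th letter of b u (k = 0, …, length u) creates the plateau m m and
-- destroys the plateau starting at the k-th or at the (k+1)-th letter, if there is one (two plateaus
-- are never adjacent). E and O count the slots with k even, resp. odd, where nothing is destroyed.
record PlateauInsertion (a b m : ℕ) (u : List ℕ) : Set where
  field
    E O     : ℕ
    E-count : E + laterPlateaus b u + 𝟙 (plateau? a b u) ≡ evens≤ (length u)
    O-count : O + laterPlateaus b u ≡ odds≤ (length u)
    ∑-shape : (G : ℕ × Bool → ℕ) →
      ∑ (insertions (m ∷ m ∷ []) u) (λ w → G (plateaus a b w , isEven (firstPos m w)))
        ≡ plateauShape (plateau? a b u) (plateaus a b u) (laterPlateaus b u) E O G

plateaus-apart : (a b z : ℕ) (u : List ℕ) → plateau? a b (z ∷ u) ∧ plateau? b z u ≡ false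
plateaus-apart a b z []      = ∧-zeroʳ _
plateaus-apart a b z (y ∷ u) with b ℕ.≟ z
... | no  _    rewrite ∧-zeroʳ ⌊ a ℕ.<? b ⌋ = refl
... | yes refl rewrite ⌊⌋-false (b ℕ.<? b) (<-irrefl refl) = ∧-zeroʳ _

plateauShape-step : (t₀ t₁ : Bool) → t₀ ∧ t₁ ≡ false → (Q E O : ℕ) (G : ℕ × Bool → ℕ) →
  G (suc Q , false) + plateauShape t₁ (𝟙 t₁ + Q) Q E O (λ (p , e) → G (𝟙 t₀ + p , not e))
    ≡ plateauShape t₀ (𝟙 t₀ + (𝟙 t₁ + Q)) (𝟙 t₁ + Q) (𝟙 (not (t₀ ∨ t₁)) + O) E G
plateauShape-step false false _ Q E O G =
  normalise (G (suc Q , false)) (G (Q , true)) (G (Q , false)) (G (suc Q , true)) Q E O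
  where
  normalise : ∀ g₀ g₁ g₂ g₃ Q E O →
    g₀ + (0 * g₁ + (Q * (g₁ + g₂) + (E * g₃ + O * g₀))) ≡ 0 * g₂ + (Q * (g₂ + g₁) + ((1 + O) * g₀ + E * g₃))
  normalise = solve-∀
plateauShape-step false true _ Q E O G =
  normalise (G (suc Q , false)) (G (suc Q , true)) (G (suc (suc Q) , false)) (G (suc (suc Q) , true)) Q E O
  where
  normalise : ∀ g₀ g₁ g₂ g₃ Q E O →
    g₀ + (1 * g₁ + (Q * (g₁ + g₀) + (E * g₃ + O * g₂))) ≡ 0 * g₀ + ((1 + Q) * (g₀ + g₁) + (O * g₂ + E * g₃))
  normalise = solve-∀
plateauShape-step true false _ Q E O G =
  normalise (G (suc Q , false)) (G (suc Q , true)) (G (suc (suc Q) , false)) (G (suc (suc Q) , true)) Q E O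
  where
  normalise : ∀ g₀ g₁ g₂ g₃ Q E O →
    g₀ + (0 * g₁ + (Q * (g₁ + g₀) + (E * g₃ + O * g₂))) ≡ 1 * g₀ + (Q * (g₀ + g₁) + (O * g₂ + E * g₃))
  normalise = solve-∀

evens-step : (t₀ t₁ : Bool) → t₀ ∧ t₁ ≡ false → (O Q : ℕ) → 𝟙 (not (t₀ ∨ t₁)) + O + (𝟙 t₁ + Q) + 𝟙 t₀ ≡ suc (O + Q)
evens-step false false _ O Q = cong suc (+-identityʳ (O + Q))
evens-step false true  _ O Q = trans (+-identityʳ (O + suc Q)) (+-suc O Q)
evens-step true  false _ O Q = trans (+-suc (O + Q) 0) (cong suc (+-identityʳ (O + Q)))

∑-plateaus-insertions-∷ : {a b m z : ℕ} (u : List ℕ) → b < m → z < m → (G : ℕ × Bool → ℕ) →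
  ∑ (insertions (m ∷ m ∷ []) (z ∷ u)) (λ w → G (plateaus a b w , isEven (firstPos m w)))
    ≡ G (suc (laterPlateaus z u) , false)
      + ∑ (insertions (m ∷ m ∷ []) u) (λ w → G (𝟙 (plateau? a b (z ∷ u)) + plateaus b z w , not (isEven (firstPos m w))))
∑-plateaus-insertions-∷ {a} {b} {m} {z} u b<m z<m G =
  cong₂ _+_ (cong G (cong₂ _,_ front first-at-1))
            (trans (∑-map (z ∷_) (insertions (m ∷ m ∷ []) u) _)
                   (∑-cong (insertions (m ∷ m ∷ []) u) (λ {w} _ → cong G (cong (_ ,_) (shifted w)))))
  where
  front : plateaus a b (m ∷ m ∷ z ∷ u) ≡ suc (laterPlateaus z u)
  front rewrite ⌊⌋-false (b ℕ.≟ m) (<⇒≢ b<m) | ∧-zeroʳ ⌊ a ℕ.<? b ⌋ | ⌊⌋-true (b ℕ.<? m) b<m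
              | ⌊⌋-true (m ℕ.≟ m) refl | ⌊⌋-false (m ℕ.<? m) (<-irrefl refl) = cong suc (plateaus-after-max u z<m)
  first-at-1 : isEven (firstPos m (m ∷ m ∷ z ∷ u)) ≡ false
  first-at-1 rewrite ⌊⌋-true (m ℕ.≟ m) refl = refl
  shifted : ∀ w → isEven (firstPos m (z ∷ w)) ≡ not (isEven (firstPos m w))
  shifted w rewrite ⌊⌋-false (z ℕ.≟ m) (<⇒≢ z<m) = isEven-suc (firstPos m w)

plateau-insertion : (a b m : ℕ) (u : List ℕ) → b < m → All (_< m) u → PlateauInsertion a b m u
plateau-insertion a b m [] b<m [] = record
  { E = 1 ; O = 0 ; E-count = refl ; O-count = refl ; ∑-shape = shape }
  where
  shape : (G : ℕ × Bool → ℕ) →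
    G (plateaus a b (m ∷ m ∷ []) , isEven (firstPos m (m ∷ m ∷ []))) + 0 ≡ 0 + (0 + ((G (1 , false) + 0) + 0))
  shape G rewrite ⌊⌋-false (b ℕ.≟ m) (<⇒≢ b<m) | ∧-zeroʳ ⌊ a ℕ.<? b ⌋ | ⌊⌋-true (b ℕ.<? m) b<m | ⌊⌋-true (m ℕ.≟ m) refl =
    sym (+-identityʳ (G (1 , false) + 0))
plateau-insertion a b m (z ∷ u) b<m (z<m ∷ u<m) = record
  { E       = E
  ; O       = IH.E
  ; E-count = trans (cong (λ P → E + P + 𝟙 t₀) (plateaus-split b z u))
                    (trans (evens-step t₀ t₁ apart IH.O Q) (cong suc IH.O-count))
  ; O-count = trans (cong (IH.E +_) (plateaus-split b z u)) (trans (reorder IH.E (𝟙 t₁) Q) IH.E-count)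
  ; ∑-shape = shape
  }
  where
  module IH = PlateauInsertion (plateau-insertion b z m u z<m u<m)
  t₀ = plateau? a b (z ∷ u)
  t₁ = plateau? b z u
  Q  = laterPlateaus z u
  E  = 𝟙 (not (t₀ ∨ t₁)) + IH.O
  apart = plateaus-apart a b z u
  reorder : ∀ E t Q → E + (t + Q) ≡ E + Q + t
  reorder = solve-∀
  shape : (G : ℕ × Bool → ℕ) →
    ∑ (insertions (m ∷ m ∷ []) (z ∷ u)) (λ w → G (plateaus a b w , isEven (firstPos m w)))
      ≡ plateauShape t₀ (plateaus a b (z ∷ u)) (laterPlateaus b (z ∷ u)) E IH.E G
  shape G = begin
    ∑ (insertions (m ∷ m ∷ []) (z ∷ u)) (λ w → G (plateaus a b w , isEven (firstPos m w)))
      ≡⟨ ∑-plateaus-insertions-∷ u b<m z<m G ⟩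
    G (suc Q , false) + ∑ (insertions (m ∷ m ∷ []) u) (λ w → G′ (plateaus b z w , isEven (firstPos m w)))
      ≡⟨ cong (G (suc Q , false) +_) (IH.∑-shape G′) ⟩
    G (suc Q , false) + plateauShape t₁ (plateaus b z u) Q IH.E IH.O G′
      ≡⟨ cong (λ P → G (suc Q , false) + plateauShape t₁ P Q IH.E IH.O G′) (plateaus-split b z u) ⟩
    G (suc Q , false) + plateauShape t₁ (𝟙 t₁ + Q) Q IH.E IH.O G′
      ≡⟨ plateauShape-step t₀ t₁ apart Q IH.E IH.O G ⟩
    plateauShape t₀ (𝟙 t₀ + (𝟙 t₁ + Q)) (𝟙 t₁ + Q) E IH.E G
      ≡⟨ cong (λ P → plateauShape t₀ (𝟙 t₀ + P) P E IH.E G) (plateaus-split b z u) ⟨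
    plateauShape t₀ (plateaus a b (z ∷ u)) (laterPlateaus b (z ∷ u)) E IH.E G
      ∎
    where
    open ≡-Reasoning
    G′ : ℕ × Bool → ℕ
    G′ (p , e) = G (𝟙 t₀ + p , not e)

H-Stirling : (c t : Bool) → c ∧ t ≡ false → (E Q ev : ℕ) (F : Stats → ℕ) →
  F (suc (𝟙 t + Q) , 𝟙 t + Q , ev)
    + (F (suc Q , suc Q , suc ev) + plateauShape t (𝟙 t + Q) Q E (E + 𝟙 t) (λ (p , e) → F (𝟙 c + p , p , 𝟙 e + ev)))
  ≡ H (E + (𝟙 t + Q)) F (𝟙 c + (𝟙 t + Q) , 𝟙 t + Q , ev)
H-Stirling false false _ E Q ev F =
  trans (normalise (F (suc Q , Q , ev)) (F (Q , Q , ev)) (F (Q , Q , suc ev))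
                   (F (suc Q , suc Q , ev)) (F (suc Q , suc Q , suc ev)) Q E)
        (sym (H-diag E Q ev F))
  where
  normalise : ∀ f₀ f₁ f₂ f₃ f₄ Q E →
    f₀ + (f₄ + (0 * f₁ + (Q * (f₁ + f₂) + (E * f₃ + (E + 0) * f₄)))) ≡ f₀ + (Q * (f₁ + f₂) + (E * f₃ + (1 + E) * f₄))
  normalise = solve-∀
H-Stirling true false _ E Q ev F =
  trans (normalise (F (suc Q , Q , ev)) (F (suc Q , Q , suc ev)) (F (suc (suc Q) , suc Q , ev))
                   (F (suc (suc Q) , suc Q , suc ev)) (F (suc Q , suc Q , suc ev)) Q E)
        (sym (H-below E Q ev F))
  where
  normalise : ∀ f₀ f₁ f₂ f₃ f₄ Q E →
    f₀ + (f₄ + (0 * f₀ + (Q * (f₀ + f₁) + (E * f₂ + (E + 0) * f₃)))) ≡ (1 + Q) * f₀ + (Q * f₁ + (E * (f₂ + f₃) + f₄))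
  normalise = solve-∀
H-Stirling false true _ E Q ev F =
  trans (normalise (F (suc (suc Q) , suc Q , ev)) (F (suc Q , suc Q , ev)) (F (suc Q , suc Q , suc ev))
                   (F (suc (suc Q) , suc (suc Q) , ev)) (F (suc (suc Q) , suc (suc Q) , suc ev)) Q E)
        (sym (H-diag E (suc Q) ev F))
  where
  normalise : ∀ f₀ f₁ f₂ f₃ f₄ Q E →
    f₀ + (f₂ + (1 * f₁ + (Q * (f₁ + f₂) + (E * f₃ + (E + 1) * f₄)))) ≡ f₀ + ((1 + Q) * (f₁ + f₂) + (E * f₃ + (1 + E) * f₄))
  normalise = solve-∀

evens-odds-double : (k : ℕ) → evens≤ (2 * k) ≡ suc k × odds≤ (2 * k) ≡ k
evens-odds-double zero = refl , refl
evens-odds-double (suc k) =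
  subst (λ L → evens≤ L ≡ suc (suc k) × odds≤ L ≡ suc k) (sym (2*suc k))
        (cong suc (proj₁ (evens-odds-double k)) , cong suc (proj₂ (evens-odds-double k)))

evens-odds-halves : (n L : ℕ) → 2 * n ≡ suc L → evens≤ L ≡ n × odds≤ L ≡ n
evens-odds-halves (suc k) L 2n≡ with refl ← suc-injective (trans (sym 2n≡) (2*suc k)) =
  cong suc (proj₂ (evens-odds-double k)) , proj₁ (evens-odds-double k)

statQ : ℕ → List ℕ → Stats
statQ n σ = lap n σ , ap n σ , even n σ

childrenQ : ℕ → List ℕ → List (List ℕ)
childrenQ n = insertions (suc (suc n) ∷ suc (suc n) ∷ [])

module _ (n x y : ℕ) (r : List ℕ) (len : 2 * n ≡ suc (length r)) (x<m : x < suc (suc n)) (y<m : y < suc (suc n)) where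

  private
    m  = suc (suc n)
    c  = plateau? 0 x (y ∷ r)
    A  = plateaus x y r
    Q  = laterPlateaus y r
    ev = even n (x ∷ y ∷ r)
    len′ : 2 * suc n ≡ suc (suc (suc (length r)))
    len′ = trans (2*suc n) (cong (suc ∘ suc) len)

  statQ-parent : statQ n (x ∷ y ∷ r) ≡ (𝟙 c + A , A , ev)
  statQ-parent = cong₂ _,_ (lap-∷ n x (y ∷ r) (sym len)) (cong (_, ev) (ap-∷ n x y r len))

  statQ-child₀ : statQ (suc n) (m ∷ m ∷ x ∷ y ∷ r) ≡ (suc A , A , ev)
  statQ-child₀ = cong₂ _,_ (trans (lap-∷ (suc n) m (m ∷ x ∷ y ∷ r) (sym len′)) lap₀)
                           (cong₂ _,_ (trans (ap-∷ (suc n) m m (x ∷ y ∷ r) len′) ap₀)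
                                      (trans (even-insertions n {x ∷ y ∷ r} (here refl)) even₀))
    where
    m≮x = ⌊⌋-false (m ℕ.<? x) (<⇒≱ (m≤n⇒m≤1+n x<m))
    lap₀ : plateaus 0 m (m ∷ x ∷ y ∷ r) ≡ suc A
    lap₀ rewrite ⌊⌋-true (m ℕ.≟ m) refl | ⌊⌋-false (m ℕ.<? m) (<-irrefl refl) | m≮x = refl
    ap₀ : plateaus m m (x ∷ y ∷ r) ≡ A
    ap₀ rewrite ⌊⌋-false (m ℕ.<? m) (<-irrefl refl) | m≮x = refl
    even₀ : 𝟙 (isEven (firstPos m (m ∷ m ∷ x ∷ y ∷ r))) + ev ≡ ev
    even₀ rewrite ⌊⌋-true (m ℕ.≟ m) refl = refl

  statQ-child₁ : statQ (suc n) (x ∷ m ∷ m ∷ y ∷ r) ≡ (suc Q , suc Q , suc ev)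
  statQ-child₁ = cong₂ _,_ (trans (lap-∷ (suc n) x (m ∷ m ∷ y ∷ r) (sym len′)) lap₁)
                           (cong₂ _,_ (trans (ap-∷ (suc n) x m (m ∷ y ∷ r) len′) ap₁)
                                      (trans (even-insertions n {x ∷ y ∷ r} (there (here refl))) even₁))
    where
    ap₁ : plateaus x m (m ∷ y ∷ r) ≡ suc Q
    ap₁ rewrite ⌊⌋-true (x ℕ.<? m) x<m | ⌊⌋-true (m ℕ.≟ m) refl | ⌊⌋-false (m ℕ.<? m) (<-irrefl refl) =
      cong suc (plateaus-after-max r y<m)
    lap₁ : plateaus 0 x (m ∷ m ∷ y ∷ r) ≡ suc Q
    lap₁ rewrite ⌊⌋-false (x ℕ.≟ m) (<⇒≢ x<m) | ∧-zeroʳ ⌊ 0 ℕ.<? x ⌋ = ap₁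
    even₁ : 𝟙 (isEven (firstPos m (x ∷ m ∷ m ∷ y ∷ r))) + ev ≡ suc ev
    even₁ rewrite ⌊⌋-false (x ℕ.≟ m) (<⇒≢ x<m) | ⌊⌋-true (m ℕ.≟ m) refl = refl

  statQ-child : {w : List ℕ} → w ∈ childrenQ n r →
    statQ (suc n) (x ∷ y ∷ w) ≡ (𝟙 c + plateaus x y w , plateaus x y w , 𝟙 (isEven (firstPos m w)) + ev)
  statQ-child {w} w∈ =
    cong₂ _,_ (lap-∷ (suc n) x (y ∷ w) (trans (cong suc lenw) (sym len′)))
              (cong₂ _,_ (ap-∷ (suc n) x y w (trans len′ (cong suc (sym lenw))))
                         (trans (even-insertions n {x ∷ y ∷ r} (there (there (∈-map⁺ (x ∷_) (∈-map⁺ (y ∷_) w∈))))) evenw))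
    where
    lenw : length w ≡ suc (suc (length r))
    lenw = length-insertions (m ∷ m ∷ []) r w∈
    evenw : 𝟙 (isEven (firstPos m (x ∷ y ∷ w))) + ev ≡ 𝟙 (isEven (firstPos m w)) + ev
    evenw rewrite ⌊⌋-false (x ℕ.≟ m) (<⇒≢ x<m) | ⌊⌋-false (y ℕ.≟ m) (<⇒≢ y<m) = refl

  ∑-childrenQ : All (_< m) r → (F : Stats → ℕ) →
    ∑ (childrenQ n (x ∷ y ∷ r)) (F ∘ statQ (suc n)) ≡ H n F (statQ n (x ∷ y ∷ r))
  ∑-childrenQ r<m F = begin
    ∑ (childrenQ n (x ∷ y ∷ r)) (F ∘ statQ (suc n))
      ≡⟨ cong₂ _+_ (cong F statQ-child₀) (cong₂ _+_ (cong F statQ-child₁) later) ⟩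
    F (suc A , A , ev) + (F (suc Q , suc Q , suc ev) + ∑ (childrenQ n r) (λ w → G (plateaus x y w , isEven (firstPos m w))))
      ≡⟨ cong (λ s → F (suc A , A , ev) + (F (suc Q , suc Q , suc ev) + s)) (PI.∑-shape G) ⟩
    F (suc A , A , ev) + (F (suc Q , suc Q , suc ev) + plateauShape t A Q PI.E PI.O G)
      ≡⟨ cong₂ (λ P O → F (suc P , P , ev) + (F (suc Q , suc Q , suc ev) + plateauShape t P Q PI.E O G)) (plateaus-split x y r) O≡ ⟩
    F (suc (𝟙 t + Q) , 𝟙 t + Q , ev) + (F (suc Q , suc Q , suc ev) + plateauShape t (𝟙 t + Q) Q PI.E (PI.E + 𝟙 t) G)
      ≡⟨ H-Stirling c t (plateaus-apart 0 x y r) PI.E Q ev F ⟩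
    H (PI.E + (𝟙 t + Q)) F (𝟙 c + (𝟙 t + Q) , 𝟙 t + Q , ev)
      ≡⟨ cong₂ (λ k P → H k F (𝟙 c + P , P , ev)) n≡ (sym (plateaus-split x y r)) ⟩
    H n F (𝟙 c + A , A , ev)
      ≡⟨ cong (H n F) statQ-parent ⟨
    H n F (statQ n (x ∷ y ∷ r))
      ∎
    where
    open ≡-Reasoning
    t = plateau? x y r
    module PI = PlateauInsertion (plateau-insertion x y m r y<m r<m)
    G : ℕ × Bool → ℕ
    G (p , e) = F (𝟙 c + p , p , 𝟙 e + ev)
    later : ∑ (map (x ∷_) (map (y ∷_) (childrenQ n r))) (F ∘ statQ (suc n))
            ≡ ∑ (childrenQ n r) (λ w → G (plateaus x y w , isEven (firstPos m w)))
    later = trans (∑-map (x ∷_) (map (y ∷_) (childrenQ n r)) _)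
                  (trans (∑-map (y ∷_) (childrenQ n r) _) (∑-cong (childrenQ n r) (cong F ∘ statQ-child)))
    halves = evens-odds-halves n (length r) len
    swap-last : ∀ E t Q → E + t + Q ≡ E + Q + t
    swap-last = solve-∀
    n≡′ : PI.E + 𝟙 t + Q ≡ n
    n≡′ = trans (swap-last PI.E (𝟙 t) Q) (trans PI.E-count (proj₁ halves))
    n≡ : PI.E + (𝟙 t + Q) ≡ n
    n≡ = trans (sym (+-assoc PI.E (𝟙 t) Q)) n≡′
    O≡ : PI.O ≡ PI.E + 𝟙 t
    O≡ = +-cancelʳ-≡ Q PI.O (PI.E + 𝟙 t) (trans PI.O-count (trans (proj₂ halves) (sym n≡′)))

leftStirling : ℕ → List ℕ → Bool
leftStirling x []      = true
leftStirling x (y ∷ w) = allᵇ (λ z → if ⌊ x ℕ.≟ z ⌋ then ⌊ x ℕ.<? y ⌋ else true) w ∧ leftStirling x w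

stirlingᵇ : List ℕ → Bool
stirlingᵇ []      = true
stirlingᵇ (x ∷ w) = leftStirling x w ∧ stirlingᵇ w

stirlingPair : List ℕ → ℕ → ℕ → Bool
stirlingPair σ i j =
  if ⌊ suc i ℕ.<? suc j ⌋ ∧ ⌊ nth 0 σ i ℕ.≟ nth 0 σ j ⌋
  then allᵇ (λ t → ⌊ nth 0 σ i ℕ.<? nth 0 σ (suc (i + t)) ⌋) (upTo (j ∸ suc i))
  else true

stirlingPairs : List ℕ → List ℕ → Bool
stirlingPairs σ is = allᵇ (λ i → allᵇ (stirlingPair σ i) is) is

leftStirlingAt : ℕ → List ℕ → Bool
leftStirlingAt x w =
  allᵇ (λ j → if ⌊ x ℕ.≟ nth 0 w j ⌋ then allᵇ (λ t → ⌊ x ℕ.<? nth 0 w t ⌋) (upTo j) else true) (upTo (length w))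

isStirling≡stirlingPairs : (σ : List ℕ) → isStirling σ ≡ stirlingPairs σ (upTo (length σ))
isStirling≡stirlingPairs σ =
  trans (allᵇ-map _ suc (upTo (length σ))) (allᵇ-cong (upTo (length σ)) λ {i} _ →
  trans (allᵇ-map _ suc (upTo (length σ))) (allᵇ-cong (upTo (length σ)) λ {j} _ →
    cong (λ b → if ⌊ suc i ℕ.<? suc j ⌋ ∧ ⌊ nth 0 σ i ℕ.≟ nth 0 σ j ⌋ then b else true)
         (allᵇ-map _ (suc (suc i) +_) (upTo (j ∸ suc i)))))

stirlingPairs-∷ : (x : ℕ) (w : List ℕ) →
  stirlingPairs (x ∷ w) (upTo (suc (length w))) ≡ leftStirlingAt x w ∧ stirlingPairs w (upTo (length w))
stirlingPairs-∷ x w = trans (cong (stirlingPairs (x ∷ w)) (upTo-suc (length w)))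
  (cong₂ _∧_ (allᵇ-map _ suc (upTo (length w)))
    (trans (allᵇ-map _ suc (upTo (length w))) (allᵇ-cong (upTo (length w)) λ {i} _ →
      trans (allᵇ-map _ suc (upTo (length w))) (allᵇ-cong (upTo (length w)) λ {j} _ →
        cong (λ b → if b ∧ ⌊ nth 0 w i ℕ.≟ nth 0 w j ⌋ then allᵇ (λ t → ⌊ nth 0 w i ℕ.<? nth 0 w (suc (i + t)) ⌋) (upTo (j ∸ suc i)) else true)
             (<?-suc (suc i) (suc j))))))

leftStirlingAt-∷ : (x y : ℕ) (w : List ℕ) →
  leftStirlingAt x (y ∷ w) ≡ allᵇ (λ z → if ⌊ x ℕ.≟ z ⌋ then ⌊ x ℕ.<? y ⌋ else true) w ∧ leftStirlingAt x w
leftStirlingAt-∷ x y w = begin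
  leftStirlingAt x (y ∷ w)
    ≡⟨ cong (allᵇ f) (upTo-suc (length w)) ⟩
  f 0 ∧ allᵇ f (map suc (upTo (length w)))
    ≡⟨ cong₂ _∧_ (if-eta ⌊ x ℕ.≟ y ⌋) (allᵇ-map f suc (upTo (length w))) ⟩
  allᵇ (f ∘ suc) (upTo (length w))
    ≡⟨ allᵇ-cong (upTo (length w)) (λ {j} _ → split j) ⟩
  allᵇ (λ j → bigger j ∧ earlier j) (upTo (length w))
    ≡⟨ allᵇ-∧ bigger earlier (upTo (length w)) ⟩
  allᵇ bigger (upTo (length w)) ∧ leftStirlingAt x w
    ≡⟨ cong (_∧ leftStirlingAt x w) (allᵇ-nth 0 (λ z → if ⌊ x ℕ.≟ z ⌋ then ⌊ x ℕ.<? y ⌋ else true) w) ⟩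
  allᵇ (λ z → if ⌊ x ℕ.≟ z ⌋ then ⌊ x ℕ.<? y ⌋ else true) w ∧ leftStirlingAt x w
    ∎
  where
  open ≡-Reasoning
  f : ℕ → Bool
  f j = if ⌊ x ℕ.≟ nth 0 (y ∷ w) j ⌋ then allᵇ (λ t → ⌊ x ℕ.<? nth 0 (y ∷ w) t ⌋) (upTo j) else true
  bigger earlier : ℕ → Bool
  bigger  j = if ⌊ x ℕ.≟ nth 0 w j ⌋ then ⌊ x ℕ.<? y ⌋ else true
  earlier j = if ⌊ x ℕ.≟ nth 0 w j ⌋ then allᵇ (λ t → ⌊ x ℕ.<? nth 0 w t ⌋) (upTo j) else true
  split : ∀ j → f (suc j) ≡ bigger j ∧ earlier j
  split j = trans (cong (λ b → if ⌊ x ℕ.≟ nth 0 w j ⌋ then b else true)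
                        (trans (cong (allᵇ (λ t → ⌊ x ℕ.<? nth 0 (y ∷ w) t ⌋)) (upTo-suc j))
                               (cong (⌊ x ℕ.<? y ⌋ ∧_) (allᵇ-map _ suc (upTo j)))))
                  (if-∧-distrib ⌊ x ℕ.≟ nth 0 w j ⌋ ⌊ x ℕ.<? y ⌋ _)

leftStirlingAt≡leftStirling : (x : ℕ) (w : List ℕ) → leftStirlingAt x w ≡ leftStirling x w
leftStirlingAt≡leftStirling x []      = refl
leftStirlingAt≡leftStirling x (y ∷ w) =
  trans (leftStirlingAt-∷ x y w)
        (cong (allᵇ (λ z → if ⌊ x ℕ.≟ z ⌋ then ⌊ x ℕ.<? y ⌋ else true) w ∧_) (leftStirlingAt≡leftStirling x w))

isStirling≡stirlingᵇ : (σ : List ℕ) → isStirling σ ≡ stirlingᵇ σ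
isStirling≡stirlingᵇ σ = trans (isStirling≡stirlingPairs σ) (pairs σ)
  where
  pairs : (σ : List ℕ) → stirlingPairs σ (upTo (length σ)) ≡ stirlingᵇ σ
  pairs []      = refl
  pairs (x ∷ w) = trans (stirlingPairs-∷ x w) (cong₂ _∧_ (leftStirlingAt≡leftStirling x w) (pairs w))

allᵇ-guard-fresh : {m : ℕ} (C : List ℕ) → All (_< m) C → (b : Bool) →
  allᵇ (λ z → if ⌊ m ℕ.≟ z ⌋ then b else true) C ≡ true
allᵇ-guard-fresh C C<m b =
  allᵇ-true C (λ z∈ → cong (λ c → if c then b else true) (⌊⌋-false (_ ℕ.≟ _) (<⇒≢ (All.lookup C<m z∈) ∘ sym)))

leftStirling-fresh : {m : ℕ} (C : List ℕ) → All (_< m) C → leftStirling m C ≡ true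
leftStirling-fresh []      []           = refl
leftStirling-fresh (y ∷ C) (_ ∷ C<m) =
  cong₂ _∧_ (allᵇ-guard-fresh C C<m _) (leftStirling-fresh C C<m)

leftStirling-insert : {x m : ℕ} → x < m → (A C : List ℕ) → leftStirling x (A ++ m ∷ m ∷ C) ≡ leftStirling x (A ++ C)
leftStirling-insert {x} {m} x<m [] C
  rewrite ⌊⌋-true (x ℕ.<? m) x<m | if-eta ⌊ x ℕ.≟ m ⌋ {true}
        | allᵇ-true {f = λ z → if ⌊ x ℕ.≟ z ⌋ then true else true} C (λ {z} _ → if-eta ⌊ x ℕ.≟ z ⌋) = refl
leftStirling-insert {x} {m} x<m (y ∷ A) C
  rewrite allᵇ-++ (λ z → if ⌊ x ℕ.≟ z ⌋ then ⌊ x ℕ.<? y ⌋ else true) A (m ∷ m ∷ C)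
        | allᵇ-++ (λ z → if ⌊ x ℕ.≟ z ⌋ then ⌊ x ℕ.<? y ⌋ else true) A C
        | ⌊⌋-false (x ℕ.≟ m) (<⇒≢ x<m) | leftStirling-insert x<m A C = refl

stirlingᵇ-insert : {m : ℕ} (A C : List ℕ) → All (_< m) A → All (_< m) C →
  stirlingᵇ (A ++ m ∷ m ∷ C) ≡ stirlingᵇ (A ++ C)
stirlingᵇ-insert {m} [] C [] C<m
  rewrite allᵇ-guard-fresh C C<m ⌊ m ℕ.<? m ⌋ | leftStirling-fresh C C<m = refl
stirlingᵇ-insert (x ∷ A) C (x<m ∷ A<m) C<m
  rewrite leftStirling-insert x<m A C | stirlingᵇ-insert A C A<m C<m = refl

stirlingᵇ-gap : {m b : ℕ} (A B C : List ℕ) → b < m → ¬ T (stirlingᵇ (A ++ m ∷ (b ∷ B) ++ m ∷ C))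
stirlingᵇ-gap (x ∷ A) B C b<m st = stirlingᵇ-gap A B C b<m (proj₂ (Equivalence.to T-∧ st))
stirlingᵇ-gap {m} {b} [] B C b<m st = <⇒≱ b<m (<⇒≤ (toWitness m<b))
  where
  between : T (allᵇ (λ z → if ⌊ m ℕ.≟ z ⌋ then ⌊ m ℕ.<? b ⌋ else true) (B ++ m ∷ C))
  between = proj₁ (Equivalence.to T-∧ (proj₁ (Equivalence.to T-∧ st)))
  m<b : T ⌊ m ℕ.<? b ⌋
  m<b = subst (λ c → T (if c then ⌊ m ℕ.<? b ⌋ else true)) (⌊⌋-true (m ℕ.≟ m) refl)
              (allᵇ⁻ _ between (∈-++⁺ʳ B (here refl)))

equals : ℕ → ℕ → Bool
equals v e = ⌊ e ℕ.≟ v ⌋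

Letter : ℕ → ℕ → Set
Letter n e = 1 ≤ e × e < suc (suc n)

∈-letters⁻ : (n : ℕ) {e : ℕ} → e ∈ range 1 (suc n) → Letter n e
∈-letters⁻ n e∈ with k , k∈ , refl ← ∈-map⁻ suc e∈ = s≤s z≤n , s≤s (∈-upTo⁻ k∈)

∈-letters⁺ : (n : ℕ) {e : ℕ} → Letter n e → e ∈ range 1 (suc n)
∈-letters⁺ n {suc k} (_ , s≤s k<) = ∈-map⁺ suc (∈-upTo⁺ k<)

letters-unique : (n : ℕ) → Unique (range 1 (suc n))
letters-unique n = Unique.map⁺ suc-injective (Unique.upTo⁺ (suc n))

record IsStirlingPerm (n : ℕ) (σ : List ℕ) : Set where
  field
    length≡  : length σ ≡ suc (2 * n)
    letters  : All (Letter n) σ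
    one-once : ∑ σ (𝟙 ∘ equals 1) ≡ 1
    twice    : ∀ {k} → k < n → ∑ σ (𝟙 ∘ equals (suc (suc k))) ≡ 2
    stirling : T (stirlingᵇ σ)

∈Q0⁻ : (n : ℕ) {σ : List ℕ} → σ ∈ Q0 n → IsStirlingPerm n σ
∈Q0⁻ n {σ} σ∈ with σ∈words , valid ← ∈-filterᵇ⁻ _ σ∈
              with multiset , stirling ← Equivalence.to T-∧ valid
              with once , twice ← Equivalence.to T-∧ multiset
              with len , inAlphabet ← ∈-words⁻ (suc (2 * n)) (range 1 (suc n)) σ∈words = record
  { length≡  = len
  ; letters  = All.map (∈-letters⁻ n) inAlphabet
  ; one-once = trans (sym (countᵇ≡∑ (equals 1) σ)) (toWitness once)
  ; twice    = λ {k} k<n → trans (sym (countᵇ≡∑ (equals (suc (suc k))) σ))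
                             (toWitness (allᵇ⁻ _ twice (∈-map⁺ (2 +_) (∈-upTo⁺ k<n))))
  ; stirling = subst T (isStirling≡stirlingᵇ σ) stirling
  }

∈Q0⁺ : (n : ℕ) {σ : List ℕ} → IsStirlingPerm n σ → σ ∈ Q0 n
∈Q0⁺ n {σ} perm = ∈-filterᵇ⁺ _
  (∈-words⁺ (suc (2 * n)) (range 1 (suc n)) length≡ (All.map (∈-letters⁺ n) letters))
  (Equivalence.from T-∧ (Equivalence.from T-∧ (once , allᵇ⁺ _ (λ v∈ → twice-at (∈-map⁻ (2 +_) v∈))) ,
                         subst T (sym (isStirling≡stirlingᵇ σ)) stirling))
  where
  open IsStirlingPerm perm
  once : T ⌊ countᵇ (equals 1) σ ℕ.≟ 1 ⌋
  once = fromWitness (trans (countᵇ≡∑ (equals 1) σ) one-once)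
  twice-at : ∀ {v} → ∃[ k ] k ∈ upTo n × v ≡ 2 + k → T ⌊ countᵇ (equals v) σ ℕ.≟ 2 ⌋
  twice-at (k , k∈ , refl) = fromWitness (trans (countᵇ≡∑ (equals (2 + k)) σ) (twice (∈-upTo⁻ k∈)))

stirlingᵇ-insertions : {m : ℕ} {σ w : List ℕ} → All (_< m) σ → w ∈ insertions (m ∷ m ∷ []) σ → stirlingᵇ w ≡ stirlingᵇ σ
stirlingᵇ-insertions {m} {σ} σ<m w∈ with A , C , refl , refl ← ∈-insertions⁻ (m ∷ m ∷ []) σ w∈ =
  stirlingᵇ-insert A C (All.++⁻ˡ A σ<m) (All.++⁻ʳ A σ<m)

Letter-strengthen : {n e : ℕ} → Letter (suc n) e → equals (suc (suc n)) e ≡ false → Letter n e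
Letter-strengthen (1≤e , e<) e≢ with m<1+n⇒m<n∨m≡n e<
... | inj₁ e<m  = 1≤e , e<m
... | inj₂ refl with () ← trans (sym (⌊⌋-true (_ ℕ.≟ _) refl)) e≢

Letter-absent : {n e : ℕ} → Letter n e → equals (suc (suc n)) e ≡ false
Letter-absent (_ , e<m) = ⌊⌋-false (_ ℕ.≟ _) (<⇒≢ e<m)

module _ {n : ℕ} {σ w : List ℕ} (w∈ : w ∈ childrenQ n σ) where

  private
    m = suc (suc n)
    m≢ : ∀ {k} → k < n → equals (suc (suc k)) m ≡ false
    m≢ k<n = ⌊⌋-false (_ ℕ.≟ _) (λ eq → <⇒≢ k<n (sym (suc-injective (suc-injective eq))))

  IsStirlingPerm-insert : IsStirlingPerm n σ → IsStirlingPerm (suc n) w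
  IsStirlingPerm-insert perm = record
    { length≡  = trans (length-insertions (m ∷ m ∷ []) σ w∈) (trans (cong (suc ∘ suc) length≡) (cong suc (sym (2*suc n))))
    ; letters  = All-insertions (m ∷ m ∷ []) σ w∈ (new ∷ new ∷ []) (All.map (λ (1≤e , e<) → 1≤e , m≤n⇒m≤1+n e<) letters)
    ; one-once = trans (∑-insertions (m ∷ m ∷ []) σ w∈ (𝟙 ∘ equals 1)) one-once
    ; twice    = λ {k} k<1+n → trans (∑-insertions (m ∷ m ∷ []) σ w∈ (𝟙 ∘ equals (suc (suc k)))) (count k<1+n)
    ; stirling = subst T (sym (stirlingᵇ-insertions (All.map proj₂ letters) w∈)) stirling
    }
    where
    open IsStirlingPerm perm
    new : Letter (suc n) m
    new = s≤s z≤n , n<1+n m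
    count : ∀ {k} → k < suc n →
      𝟙 (equals (suc (suc k)) m) + (𝟙 (equals (suc (suc k)) m) + 0) + ∑ σ (𝟙 ∘ equals (suc (suc k))) ≡ 2
    count {k} k<1+n with m<1+n⇒m<n∨m≡n k<1+n
    ... | inj₁ k<n  rewrite m≢ k<n = twice k<n
    ... | inj₂ refl rewrite ⌊⌋-true (m ℕ.≟ m) refl = cong (2 +_) (All⇒∑𝟙≡0 (equals m) (All.map Letter-absent letters))

  IsStirlingPerm-remove : All (λ e → equals m e ≡ false) σ → IsStirlingPerm (suc n) w → IsStirlingPerm n σ
  IsStirlingPerm-remove others perm = record
    { length≡  = suc-injective (suc-injective (trans (sym (length-insertions (m ∷ m ∷ []) σ w∈)) (trans length≡ (cong suc (2*suc n)))))
    ; letters  = letters′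
    ; one-once = trans (sym (∑-insertions (m ∷ m ∷ []) σ w∈ (𝟙 ∘ equals 1))) one-once
    ; twice    = λ {k} k<n → trans (sym (remove-m k<n))
                               (trans (sym (∑-insertions (m ∷ m ∷ []) σ w∈ (𝟙 ∘ equals (suc (suc k))))) (twice (m≤n⇒m≤1+n k<n)))
    ; stirling = subst T (stirlingᵇ-insertions (All.map proj₂ letters′) w∈) stirling
    }
    where
    open IsStirlingPerm perm
    letters′ : All (Letter n) σ
    letters′ = All.zipWith (λ (l , e≢) → Letter-strengthen l e≢) (All-insertions⁻ (m ∷ m ∷ []) σ w∈ letters , others)
    remove-m : ∀ {k} → k < n →
      𝟙 (equals (suc (suc k)) m) + (𝟙 (equals (suc (suc k)) m) + 0) + ∑ σ (𝟙 ∘ equals (suc (suc k))) ≡ ∑ σ (𝟙 ∘ equals (suc (suc k)))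
    remove-m k<n rewrite m≢ k<n = refl

childrenQ⊆Q0 : (n : ℕ) {σ w : List ℕ} → σ ∈ Q0 n → w ∈ childrenQ n σ → w ∈ Q0 (suc n)
childrenQ⊆Q0 n σ∈ w∈ = ∈Q0⁺ (suc n) (IsStirlingPerm-insert w∈ (∈Q0⁻ n σ∈))

-- A smaller letter between the two copies of the new maximum would violate the Stirling condition.
parentQ : (n : ℕ) {w : List ℕ} → w ∈ Q0 (suc n) → ∃[ σ ] σ ∈ Q0 n × w ∈ childrenQ n σ
parentQ n {w} w∈ with perm ← ∈Q0⁻ (suc n) w∈
  with A , v , R , refl , v≡ , A₀ , R₁ ← split-at-first (equals (suc (suc n))) w (IsStirlingPerm.twice perm (n<1+n n))
  with B , v′ , C , refl , v′≡ , B₀ , C₀ ← split-at-first (equals (suc (suc n))) R R₁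
  with refl ← ⌊⌋-true⁻ (v ℕ.≟ suc (suc n)) v≡ | refl ← ⌊⌋-true⁻ (v′ ℕ.≟ suc (suc n)) v′≡ = adjacent B refl B₀
  where
  m = suc (suc n)
  adjacent : (B′ : List ℕ) → B′ ≡ B → ∑ B′ (𝟙 ∘ equals m) ≡ 0 → ∃[ σ ] σ ∈ Q0 n × A ++ m ∷ B′ ++ m ∷ C ∈ childrenQ n σ
  adjacent []       refl _  =
    A ++ C , ∈Q0⁺ n (IsStirlingPerm-remove (∈-insertions⁺ (m ∷ m ∷ []) A C) others perm) , ∈-insertions⁺ (m ∷ m ∷ []) A C
    where
    others : All (λ e → equals m e ≡ false) (A ++ C)
    others = ∑𝟙≡0⇒All (equals m) (A ++ C) (trans (∑-++ A C _) (cong₂ _+_ A₀ C₀))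
  adjacent (b ∷ B′) refl B₀′ = contradiction (IsStirlingPerm.stirling perm) (stirlingᵇ-gap A B′ C b<m)
    where
    b-letter : Letter (suc n) b
    b-letter = All.head (All.++⁻ʳ (m ∷ []) (All.++⁻ʳ A (IsStirlingPerm.letters perm)))
    b<m : b < m
    b<m = proj₂ (Letter-strengthen b-letter (All.head (∑𝟙≡0⇒All (equals m) (b ∷ B′) B₀′)))

childrenQ-unique : (n : ℕ) {σ : List ℕ} → σ ∈ Q0 n → Unique (childrenQ n σ)
childrenQ-unique n σ∈ =
  insertions-unique (suc (suc n)) (suc (suc n) ∷ []) (All.map (λ (_ , e<m) → <⇒≢ e<m ∘ sym) (IsStirlingPerm.letters (∈Q0⁻ n σ∈)))

eraseQ : ℕ → List ℕ → List ℕ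
eraseQ n = filterᵇ (not ∘ equals (suc (suc n)))

eraseQ-childrenQ : (n : ℕ) {σ w : List ℕ} → σ ∈ Q0 n → w ∈ childrenQ n σ → eraseQ n w ≡ σ
eraseQ-childrenQ n {σ} σ∈ w∈ =
  filterᵇ-insertions (m ∷ m ∷ []) σ w∈ (not ∘ equals m) (erased ∷ erased ∷ [])
    (All.map (cong not ∘ Letter-absent) (IsStirlingPerm.letters (∈Q0⁻ n σ∈)))
  where
  m = suc (suc n)
  erased : not (equals m m) ≡ false
  erased = cong not (⌊⌋-true (m ℕ.≟ m) refl)

Q0-unique : (n : ℕ) → Unique (Q0 n)
Q0-unique n = Unique.filter⁺ (T? ∘ λ σ → hasMultiset n σ ∧ isStirling σ) (words-unique (suc (2 * n)) (letters-unique n))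

Q0-step : (n : ℕ) → Q0 (suc n) ↭ concatMap (childrenQ n) (Q0 n)
Q0-step n = ↭-concatMap-children (childrenQ n) (eraseQ n) (Q0-unique n) (Q0-unique (suc n))
  (childrenQ-unique n) (eraseQ-childrenQ n) (childrenQ⊆Q0 n) (parentQ n)

∑-childrenQ-IsStirlingPerm : {n : ℕ} {σ : List ℕ} → IsStirlingPerm (suc n) σ → (F : Stats → ℕ) →
  ∑ (childrenQ (suc n) σ) (F ∘ statQ (suc (suc n))) ≡ H (suc n) F (statQ (suc n) σ)
∑-childrenQ-IsStirlingPerm {σ = []}    record { length≡ = () }
∑-childrenQ-IsStirlingPerm {σ = _ ∷ []} record { length≡ = () }
∑-childrenQ-IsStirlingPerm {n} {x ∷ y ∷ r} record { length≡ = len ; letters = (_ , x<m) ∷ (_ , y<m) ∷ r-letters } =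
  ∑-childrenQ (suc n) x y r (sym (suc-injective len)) x<m y<m (All.map proj₂ r-letters)

∑-Q0-step : (n : ℕ) (F : Stats → ℕ) →
  ∑ (Q0 (suc (suc n))) (F ∘ statQ (suc (suc n))) ≡ ∑ (Q0 (suc n)) (H (suc n) F ∘ statQ (suc n))
∑-Q0-step n F = begin
  ∑ (Q0 (suc (suc n))) (F ∘ statQ (suc (suc n)))
    ≡⟨ ∑-↭ _ (Q0-step (suc n)) ⟩
  ∑ (concatMap (childrenQ (suc n)) (Q0 (suc n))) (F ∘ statQ (suc (suc n)))
    ≡⟨ ∑-concatMap (childrenQ (suc n)) (Q0 (suc n)) _ ⟩
  ∑ (Q0 (suc n)) (λ σ → ∑ (childrenQ (suc n) σ) (F ∘ statQ (suc (suc n))))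
    ≡⟨ ∑-cong (Q0 (suc n)) (λ σ∈ → ∑-childrenQ-IsStirlingPerm (∈Q0⁻ (suc n) σ∈) F) ⟩
  ∑ (Q0 (suc n)) (H (suc n) F ∘ statQ (suc n))
    ∎
  where open ≡-Reasoning

∑SB≡∑Q0 : (n : ℕ) → 1 ≤ n → (F : Stats → ℕ) → ∑ (SB n) (F ∘ statB n) ≡ ∑ (Q0 n) (F ∘ statQ n)
-- 𝔖₁ᴮ = {1, −1} and Q⁽⁰⁾₂ = {122, 221} have statistics (1,0,0), (1,1,1), resp. (1,1,1), (1,0,0).
∑SB≡∑Q0 1             _ F = swap (F (1 , 0 , 0)) (F (1 , 1 , 1))
  where
  swap : ∀ a b → a + (b + 0) ≡ b + (a + 0)
  swap = solve-∀
∑SB≡∑Q0 (suc (suc n)) _ F = begin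
  ∑ (SB (suc (suc n))) (F ∘ statB (suc (suc n)))  ≡⟨ ∑-SB-step n F ⟩
  ∑ (SB (suc n)) (H (suc n) F ∘ statB (suc n))    ≡⟨ ∑SB≡∑Q0 (suc n) (s≤s z≤n) (H (suc n) F) ⟩
  ∑ (Q0 (suc n)) (H (suc n) F ∘ statQ (suc n))    ≡⟨ ∑-Q0-step n F ⟨
  ∑ (Q0 (suc (suc n))) (F ∘ statQ (suc (suc n)))  ∎
  where open ≡-Reasoning

hasStats : ℕ → ℕ → ℕ → Stats → Bool
hasStats a b c (a′ , b′ , c′) = ⌊ a′ ℕ.≟ a ⌋ ∧ ⌊ b′ ℕ.≟ b ⌋ ∧ ⌊ c′ ℕ.≟ c ⌋

theorem3 : (n : ℕ) → 1 ≤ n → (a b c : ℕ) → coeffB n a b c ≡ coeffQ n a b c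
theorem3 n 1≤n a b c = begin
  coeffB n a b c                          ≡⟨ countᵇ≡∑ _ (SB n) ⟩
  ∑ (SB n) (𝟙 ∘ hasStats a b c ∘ statB n) ≡⟨ ∑SB≡∑Q0 n 1≤n (𝟙 ∘ hasStats a b c) ⟩
  ∑ (Q0 n) (𝟙 ∘ hasStats a b c ∘ statQ n) ≡⟨ countᵇ≡∑ _ (Q0 n) ⟨
  coeffQ n a b c                          ∎
  where open ≡-Reasoning
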